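{- Let $q$ be a prime power with $q\equiv 5\pmod 8$. Then $\left|S_{\mathbb{F}_q}^{\mathrm{cyc}}\right|=\frac14\left|S_{\mathbb{F}_q}^{\mathrm{adv}_\infty}\right|$.
   Context: Let $K$ be a field of characteristic not $2$. $S_K=\{(\alpha,\beta)\in K^2:\alpha,\beta,\alpha+\beta,\alpha-\beta\neq 0\}$. For $(\alpha,\beta),(\gamma,\delta)\in S_K$ write $(\alpha,\beta)\mapsto(\gamma,\delta)$ if $2\gamma=\alpha+\beta$ and $\delta^2=\alpha\beta$. For $n\ge0$, $S_K^{\mathrm{adv}_n}$ (resp. $S_K^{\mathrm{back}_n}$) is the set of $x_0\in S_K$ admitting $x_1,\dots,x_n\in S_K$ with $x_0\mapsto x_1\mapsto\cdots\mapsto x_n$ (resp. $x_{ -1},\dots,x_{ -n}\in S_K$ with $x_{ -n}\mapsto\cdots\mapsto x_{ -1}\mapsto x_0$); $S_K^{\mathrm{adv}_\infty}=\bigcap_n S_K^{\mathrm{adv}_n}$, $S_K^{\mathrm{back}_\infty}=\bigcap_n S_K^{\mathrm{back}_n}$, and $S_K^{\mathrm{cyc}}=S_K^{\mathrm{adv}_\infty}\cap S_K^{\mathrm{back}_\infty}$. -}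

module Defs where

open import Level using (0ℓ)
open import Data.Nat as ℕ using (ℕ; zero; suc)
open import Data.Nat.Primality using (Prime)
open import Data.Fin using (Fin)
open import Data.Product using (Σ; ∃; _×_; _,_)
open import Data.List using (List; length)
open import Data.List.Membership.Propositional using (_∈_)
open import Data.List.Relation.Unary.Unique.Propositional using (Unique)
open import Relation.Nullary using (¬_)
open import Relation.Binary.PropositionalEquality using (_≡_)
open import Algebra.Structures using (IsCommutativeRing)
open import Function.Bundles using (_↔_; _⇔_)

record Field : Set₁ where
  infixl 6 _+_
  infixl 7 _*_
  field
    Carrier : Set
    _+_ _*_ : Carrier → Carrier → Carrier
    -_ : Carrier → Carrier
    0# 1# : Carrier
    isCommutativeRing : IsCommutativeRing _≡_ _+_ _*_ -_ 0# 1#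
    0≢1 : ¬ (0# ≡ 1#)
    inverse : ∀ x → ¬ (x ≡ 0#) → ∃ λ y → x * y ≡ 1#

IsPrimePower : ℕ → Set
IsPrimePower q = ∃ λ p → ∃ λ k → Prime p × (q ≡ p ℕ.^ suc k)

HasSize : Field → ℕ → Set
HasSize K q = Fin q ↔ Field.Carrier K

HasCard : {A : Set} → (A → Set) → ℕ → Set
HasCard {A} P n = ∃ λ (l : List A) → Unique l × (length l ≡ n) × (∀ x → (x ∈ l) ⇔ P x)

module _ (K : Field) where
  open Field K

  Pair : Set
  Pair = Carrier × Carrier

  InS : Pair → Set
  InS (α , β) = ¬ (α ≡ 0#) × ¬ (β ≡ 0#) × ¬ (α + β ≡ 0#) × ¬ (α + - β ≡ 0#)

  Step : Pair → Pair → Set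
  Step (α , β) (γ , δ) = InS (α , β) × InS (γ , δ)
                        × (γ + γ ≡ α + β) × (δ * δ ≡ α * β)

  Adv : ℕ → Pair → Set
  Adv zero x = InS x
  Adv (suc n) x = ∃ λ y → Step x y × Adv n y

  Back : ℕ → Pair → Set
  Back zero x = InS x
  Back (suc n) x = ∃ λ y → Step y x × Back n y

  AdvInf : Pair → Set
  AdvInf x = ∀ n → Adv n x

  BackInf : Pair → Set
  BackInf x = ∀ n → Back n x

  Cyc : Pair → Set
  Cyc x = AdvInf x × BackInf x

{-# OPTIONS --safe #-}
-- A step (a , b) ↦ (γ , δ) has γ the mean of a and b and δ² = a b, so the successors of (a , b)
-- are (γ , ± √ (a b)), and the predecessors of (c , d) are (c + ε , c - ε) and its swap, where
-- ε² = c² - d². When q ≡ 5 (mod 8), -1 = i² for a non-square i: counting the nonzero squares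
-- and the fourth powers by pairing x with - x and with x ⁻¹ shows that -1 is a square but not
-- a fourth power. Multiplicativity of the quadratic character then shows that of the two
-- successors of a point that advances twice, exactly one again advances twice, and likewise
-- for predecessors. So advancing (retreating) forever is advancing (retreating) twice, and
-- advancing is a map next on these points. It is two-to-one, the preimages of y being its
-- predecessor and that predecessor swapped: from the advancing points onto those that also
-- have a predecessor, and from these onto the cyclic points.
module Submission where

open import Level using (0ℓ)
open import Algebra.Bundles using (CommutativeRing; RawRing)
open import Data.Bool using (Bool; true; false; not; _xor_; if_then_else_)
open import Data.Bool.Properties using (not-distribʳ-xor; not-involutive)
open import Data.Unit using (⊤; tt)
open import Data.Fin as Fin using (Fin)
open import Data.List using (List; []; _∷_; length; filter; tabulate; cartesianProduct)
open import Data.List.Properties using (filter-none; filter-all; filter-accept; filter-some; length-tabulate)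
open import Data.List.Membership.Propositional using (_∈_; lose)
import Data.List.Membership.DecPropositional as DecMembership
open import Data.List.Membership.Propositional.Properties using (∈-filter⁺; ∈-filter⁻; ∈-tabulate⁺; ∈-cartesianProduct⁺)
open import Data.List.Relation.Unary.All as All using (All)
open import Data.List.Relation.Unary.Any using (here; there; any?; satisfied)
open import Data.List.Relation.Unary.AllPairs using ([]; _∷_)
open import Data.List.Relation.Unary.Unique.Propositional using (Unique)
import Data.List.Relation.Unary.Unique.Propositional.Properties as Unique
open import Data.Maybe using (Maybe; just; nothing)
open import Data.Nat as ℕ using (ℕ; zero; suc; _∸_; _≤_)
import Data.Nat.Properties as ℕ
open import Data.Nat.DivMod using (_%_; [m+kn]%n≡m%n; m∣n⇒o%n%m≡o%m)
open import Data.Nat.Tactic.RingSolver using (solve-∀)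
open import Data.Nat.Divisibility using (divides)
open import Data.Product using (∃; _×_; _,_; proj₁; proj₂; swap)
open import Data.Product.Properties using (≡-dec)
open import Data.Sum using (_⊎_; inj₁; inj₂; [_,_]; [_,_]′)
open import Function using (_∘_; _⇔_; mk⇔; Equivalence; Inverse; _↔_)
import Function.Properties.Equivalence as ⇔
open import Relation.Binary.Definitions using (DecidableEquality)
open import Relation.Binary.PropositionalEquality using (_≡_; _≢_; refl; sym; trans; cong; cong₂; subst; module ≡-Reasoning)
import Relation.Binary.PropositionalEquality as ≡
open import Relation.Nullary using (¬_; Dec; yes; no; contradiction; ¬?; _×-dec_)
open import Relation.Nullary.Decidable using (map′; isYes; isNo; decidable-stable)
open import Relation.Unary using (Pred; Decidable; _∩_; ∁; _⊆_)
open import Relation.Unary.Properties using (_∩?_; ∁?; U?)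

open import Defs

-- The standard library's solvers for an arbitrary commutative ring use the ring itself as coefficients,
-- so they cannot cancel terms; here the coefficients are integers.
module IntegerCoefficientSolver {c ℓ} (R : CommutativeRing c ℓ) where

  open CommutativeRing R renaming (refl to ≈-refl; sym to ≈-sym; trans to ≈-trans)
  open import Algebra.Properties.Ring ring using (-0#≈0#; -‿distribˡ-*; x[y-z]≈xy-xz)
  open import Algebra.Properties.AbelianGroup +-abelianGroup using (⁻¹-∙-comm; ⁻¹-anti-homo‿-)
  open import Algebra.Properties.CommutativeSemigroup +-commutativeSemigroup using (interchange)
  open import Algebra.Properties.Semiring.Mult.TCOptimised semiring using (×-homo-+; ×1-homo-*) renaming (_×_ to _×′_)
  open import Algebra.Solver.Ring.AlmostCommutativeRing using (fromCommutativeRing; _-Raw-AlmostCommutative⟶_)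
  open import Relation.Binary.Reasoning.Setoid setoid

  private
    -- The integer a - b is represented by the pair (a , b).
    ℤ₂ : Set
    ℤ₂ = ℕ × ℕ

    normalise : ℕ → ℕ → ℤ₂
    normalise a b = (a ∸ b , b ∸ a)

    coefficients : RawRing _ _
    coefficients = record
      { Carrier = ℤ₂
      ; _≈_ = ≡._≡_
      ; _+_ = λ { (a , b) (c , d) → normalise (a ℕ.+ c) (b ℕ.+ d) }
      ; _*_ = λ { (a , b) (c , d) → normalise (a ℕ.* c ℕ.+ b ℕ.* d) (a ℕ.* d ℕ.+ b ℕ.* c) }
      ; -_ = λ { (a , b) → (b , a) }
      ; 0# = (0 , 0)
      ; 1# = (1 , 0)
      }

    -- With the optimised ×′, ⟦ 2 , 0 ⟧ is 1# + 1# on the nose, so numerals in solver goals need no rewriting.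
    ⟦_⟧ : ℤ₂ → Carrier
    ⟦ a , zero ⟧ = a ×′ 1#
    ⟦ zero , suc b ⟧ = - (suc b ×′ 1#)
    ⟦ suc a , suc b ⟧ = ⟦ a , b ⟧

    cancelˡ : ∀ x y z → (x + y) - (x + z) ≈ y - z
    cancelˡ x y z = begin
      (x + y) - (x + z)     ≈⟨ +-congˡ (⁻¹-∙-comm x z) ⟨
      (x + y) + (- x - z)   ≈⟨ interchange x y (- x) (- z) ⟩
      (x - x) + (y - z)     ≈⟨ +-congʳ (-‿inverseʳ x) ⟩
      0# + (y - z)          ≈⟨ +-identityˡ _ ⟩
      y - z                 ∎

    ⟦⟧-difference : ∀ a b → ⟦ a , b ⟧ ≈ a ×′ 1# - b ×′ 1#
    ⟦⟧-difference a zero = ≈-sym (≈-trans (+-congˡ -0#≈0#) (+-identityʳ _))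
    ⟦⟧-difference zero (suc b) = ≈-sym (+-identityˡ _)
    ⟦⟧-difference (suc a) (suc b) = begin
      ⟦ a , b ⟧                         ≈⟨ ⟦⟧-difference a b ⟩
      a ×′ 1# - b ×′ 1#                 ≈⟨ cancelˡ 1# (a ×′ 1#) (b ×′ 1#) ⟨
      (1# + a ×′ 1#) - (1# + b ×′ 1#)   ≈⟨ +-cong (×-homo-+ 1# 1 a) (-‿cong (×-homo-+ 1# 1 b)) ⟨
      suc a ×′ 1# - suc b ×′ 1#         ∎

    ⟦normalise⟧ : ∀ a b → ⟦ normalise a b ⟧ ≈ ⟦ a , b ⟧
    ⟦normalise⟧ zero zero = ≈-refl
    ⟦normalise⟧ zero (suc b) = ≈-refl
    ⟦normalise⟧ (suc a) zero = ≈-refl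
    ⟦normalise⟧ (suc a) (suc b) = ⟦normalise⟧ a b

    +-homo : ∀ a b c d → ⟦ normalise (a ℕ.+ c) (b ℕ.+ d) ⟧ ≈ ⟦ a , b ⟧ + ⟦ c , d ⟧
    +-homo a b c d = begin
      ⟦ normalise (a ℕ.+ c) (b ℕ.+ d) ⟧
        ≈⟨ ≈-trans (⟦normalise⟧ (a ℕ.+ c) (b ℕ.+ d)) (⟦⟧-difference (a ℕ.+ c) (b ℕ.+ d)) ⟩
      (a ℕ.+ c) ×′ 1# - (b ℕ.+ d) ×′ 1#     ≈⟨ +-cong (×-homo-+ 1# a c) (-‿cong (×-homo-+ 1# b d)) ⟩
      (A + C) - (B + D)                     ≈⟨ +-congˡ (⁻¹-∙-comm B D) ⟨
      (A + C) + (- B - D)                   ≈⟨ interchange A C (- B) (- D) ⟩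
      (A - B) + (C - D)                     ≈⟨ +-cong (⟦⟧-difference a b) (⟦⟧-difference c d) ⟨
      ⟦ a , b ⟧ + ⟦ c , d ⟧                 ∎
      where A = a ×′ 1#; B = b ×′ 1#; C = c ×′ 1#; D = d ×′ 1#

    *-homo : ∀ a b c d → ⟦ normalise (a ℕ.* c ℕ.+ b ℕ.* d) (a ℕ.* d ℕ.+ b ℕ.* c) ⟧ ≈ ⟦ a , b ⟧ * ⟦ c , d ⟧
    *-homo a b c d = begin
      ⟦ normalise (a ℕ.* c ℕ.+ b ℕ.* d) (a ℕ.* d ℕ.+ b ℕ.* c) ⟧
        ≈⟨ ≈-trans (⟦normalise⟧ m n) (⟦⟧-difference m n) ⟩
      (a ℕ.* c ℕ.+ b ℕ.* d) ×′ 1# - (a ℕ.* d ℕ.+ b ℕ.* c) ×′ 1#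
        ≈⟨ +-cong (≈-trans (×-homo-+ 1# (a ℕ.* c) (b ℕ.* d)) (+-cong (×1-homo-* a c) (×1-homo-* b d)))
                  (-‿cong (≈-trans (×-homo-+ 1# (a ℕ.* d) (b ℕ.* c)) (+-cong (×1-homo-* a d) (×1-homo-* b c)))) ⟩
      (A * C + B * D) - (A * D + B * C)     ≈⟨ +-congˡ (⁻¹-∙-comm (A * D) (B * C)) ⟨
      (A * C + B * D) + (- (A * D) - B * C) ≈⟨ interchange (A * C) (B * D) (- (A * D)) (- (B * C)) ⟩
      (A * C - A * D) + (B * D - B * C)
        ≈⟨ +-cong (x[y-z]≈xy-xz A C D) (≈-trans (-‿cong (x[y-z]≈xy-xz B C D)) (⁻¹-anti-homo‿- (B * C) (B * D))) ⟨
      A * (C - D) + - (B * (C - D))         ≈⟨ +-congˡ (-‿distribˡ-* B (C - D)) ⟩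
      A * (C - D) + - B * (C - D)           ≈⟨ distribʳ (C - D) A (- B) ⟨
      (A - B) * (C - D)                     ≈⟨ *-cong (⟦⟧-difference a b) (⟦⟧-difference c d) ⟨
      ⟦ a , b ⟧ * ⟦ c , d ⟧                 ∎
      where A = a ×′ 1#; B = b ×′ 1#; C = c ×′ 1#; D = d ×′ 1#
            m = a ℕ.* c ℕ.+ b ℕ.* d; n = a ℕ.* d ℕ.+ b ℕ.* c

    -‿homo : ∀ a b → ⟦ b , a ⟧ ≈ - ⟦ a , b ⟧
    -‿homo a b = begin
      ⟦ b , a ⟧              ≈⟨ ⟦⟧-difference b a ⟩
      b ×′ 1# - a ×′ 1#      ≈⟨ ⁻¹-anti-homo‿- (a ×′ 1#) (b ×′ 1#) ⟨
      - (a ×′ 1# - b ×′ 1#)  ≈⟨ -‿cong (⟦⟧-difference a b) ⟨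
      - ⟦ a , b ⟧            ∎

    homomorphism : coefficients -Raw-AlmostCommutative⟶ fromCommutativeRing R
    homomorphism = record
      { ⟦_⟧ = ⟦_⟧
      ; +-homo = λ { (a , b) (c , d) → +-homo a b c d }
      ; *-homo = λ { (a , b) (c , d) → *-homo a b c d }
      ; -‿homo = λ { (a , b) → -‿homo a b }
      ; 0-homo = ≈-refl
      ; 1-homo = ≈-refl
      }

    -- Coefficients are kept normalised, so syntactic equality decides equality of the integers they denote.
    _≟ᶜ_ : ∀ x y → Maybe (⟦ x ⟧ ≈ ⟦ y ⟧)
    x ≟ᶜ y with ≡-dec ℕ._≟_ ℕ._≟_ x y
    ... | yes ≡.refl = just ≈-refl
    ... | no _       = nothing

  open import Algebra.Solver.Ring coefficients (fromCommutativeRing R) homomorphism _≟ᶜ_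
    public using (solve; _:=_; _:+_; _:*_; _:-_; :-_; con)

record Enumeration (A : Set) : Set where
  infix 4 _≟_
  field
    _≟_ : DecidableEquality A
    elements : List A
    unique : Unique elements
    complete : ∀ x → x ∈ elements

enumerationFromFin : ∀ {A n} → Fin n ↔ A → Enumeration A
enumerationFromFin {A} {n} e = record
  { _≟_ = λ x y → map′ (λ eq → trans (sym (to∘from x)) (trans (cong to eq) (to∘from y))) (cong from) (from x Fin.≟ from y)
  ; elements = tabulate to
  ; unique = Unique.tabulate⁺ (λ eq → trans (sym (from∘to _)) (trans (cong from eq) (from∘to _)))
  ; complete = λ x → subst (_∈ tabulate to) (to∘from x) (∈-tabulate⁺ (from x))
  }
  where
  open Inverse e using (to; from) renaming (strictlyInverseˡ to to∘from; strictlyInverseʳ to from∘to)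

length-enumerationFromFin : ∀ {A n} (e : Fin n ↔ A) → length (Enumeration.elements (enumerationFromFin e)) ≡ n
length-enumerationFromFin e = length-tabulate (Inverse.to e)

enumerationPair : ∀ {A B} → Enumeration A → Enumeration B → Enumeration (A × B)
enumerationPair EA EB = record
  { _≟_ = ≡-dec (Enumeration._≟_ EA) (Enumeration._≟_ EB)
  ; elements = cartesianProduct (Enumeration.elements EA) (Enumeration.elements EB)
  ; unique = Unique.cartesianProduct⁺ (Enumeration.unique EA) (Enumeration.unique EB)
  ; complete = λ (x , y) → ∈-cartesianProduct⁺ (Enumeration.complete EA x) (Enumeration.complete EB y)
  }

count : ∀ {A : Set} {P : Pred A 0ℓ} → Decidable P → List A → ℕ
count P? xs = length (filter P? xs)

module _ {A : Set} where

  count-cong : ∀ {P Q : Pred A 0ℓ} (P? : Decidable P) (Q? : Decidable Q) →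
    (∀ x → P x ⇔ Q x) → ∀ xs → count P? xs ≡ count Q? xs
  count-cong P? Q? P⇔Q [] = refl
  count-cong P? Q? P⇔Q (x ∷ xs) with P? x | Q? x
  ... | yes _  | yes _  = cong suc (count-cong P? Q? P⇔Q xs)
  ... | no  _  | no  _  = count-cong P? Q? P⇔Q xs
  ... | yes px | no ¬qx = contradiction (Equivalence.to (P⇔Q x) px) ¬qx
  ... | no ¬px | yes qx = contradiction (Equivalence.from (P⇔Q x) qx) ¬px

  count-split : ∀ {P Q : Pred A 0ℓ} (P? : Decidable P) (Q? : Decidable Q) →
    ∀ xs → count P? xs ≡ count (P? ∩? Q?) xs ℕ.+ count (P? ∩? ∁? Q?) xs
  count-split P? Q? [] = refl
  count-split P? Q? (x ∷ xs) with P? x | Q? x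
  ... | yes _ | yes _ = cong suc (count-split P? Q? xs)
  ... | yes _ | no  _ = trans (cong suc (count-split P? Q? xs)) (sym (ℕ.+-suc _ _))
  ... | no  _ | _     = count-split P? Q? xs

  count-complement : ∀ {P : Pred A 0ℓ} (P? : Decidable P) xs → count P? xs ℕ.+ count (∁? P?) xs ≡ length xs
  count-complement P? [] = refl
  count-complement P? (x ∷ xs) with P? x
  ... | yes _ = cong suc (count-complement P? xs)
  ... | no  _ = trans (ℕ.+-suc _ _) (cong suc (count-complement P? xs))

  count-≡ : (_≟_ : DecidableEquality A) {a : A} {xs : List A} →
    Unique xs → a ∈ xs → count (_≟ a) xs ≡ 1
  count-≡ _≟_ {a} (a∉xs ∷ _) (here refl) =
    trans (cong length (filter-accept (_≟ a) refl))
          (cong suc (cong length (filter-none (_≟ a) (All.map (λ a≢x x≡a → a≢x (sym x≡a)) a∉xs))))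
  count-≡ _≟_ {a} {x ∷ xs} (x∉xs ∷ u) (there a∈xs) with x ≟ a
  ... | yes refl = contradiction refl (All.lookup x∉xs a∈xs)
  ... | no _     = count-≡ _≟_ u a∈xs

module Cardinality {A : Set} (E : Enumeration A) where
  open Enumeration E
  open DecMembership _≟_ using (_∈?_)
  open ≡-Reasoning

  ∣_∣ : {P : Pred A 0ℓ} → Decidable P → ℕ
  ∣ P? ∣ = count P? elements

  private
    variable
      P Q R : Pred A 0ℓ
      x : A

  ∃? : Decidable P → Dec (∃ P)
  ∃? P? = map′ satisfied (λ (x , px) → lose (complete x) px) (any? P? elements)

  Image : Pred A 0ℓ → (A → A) → Pred A 0ℓ
  Image P f y = ∃ λ x → P x × f x ≡ y

  opaque
    image? : Decidable P → (f : A → A) → Decidable (Image P f)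
    image? P? f y = ∃? (P? ∩? (λ x → f x ≟ y))

  hasCard : (P? : Decidable P) → (∀ x → P x ⇔ Q x) → HasCard Q ∣ P? ∣
  hasCard P? P⇔Q = filter P? elements , Unique.filter⁺ P? {elements} unique , refl , λ x →
    mk⇔ (Equivalence.to (P⇔Q x) ∘ proj₂ ∘ ∈-filter⁻ P? {xs = elements}) (∈-filter⁺ P? (complete x) ∘ Equivalence.from (P⇔Q x))

  ∣∣-cong : (P? : Decidable P) (Q? : Decidable Q) → (∀ x → P x ⇔ Q x) → ∣ P? ∣ ≡ ∣ Q? ∣
  ∣∣-cong P? Q? P⇔Q = count-cong P? Q? P⇔Q elements

  ∣∣-split : (P? : Decidable P) (Q? : Decidable Q) → ∣ P? ∣ ≡ ∣ P? ∩? Q? ∣ ℕ.+ ∣ P? ∩? ∁? Q? ∣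
  ∣∣-split P? Q? = count-split P? Q? elements

  ∣∣-empty : (P? : Decidable P) → (∀ x → ¬ P x) → ∣ P? ∣ ≡ 0
  ∣∣-empty P? ¬P = cong length (filter-none P? {elements} (All.tabulate λ {x} _ → ¬P x))

  ∣∣-nonempty : (P? : Decidable P) → P x → 0 ℕ.< ∣ P? ∣
  ∣∣-nonempty {x = x} P? px = filter-some P? (lose (complete x) px)

  ∣∣-all : (P? : Decidable P) → (∀ x → P x) → ∣ P? ∣ ≡ length elements
  ∣∣-all P? P-all = cong length (filter-all P? {elements} (All.tabulate λ {x} _ → P-all x))

  ∣∣-complement : (P? : Decidable P) → ∣ P? ∣ ℕ.+ ∣ ∁? P? ∣ ≡ length elements
  ∣∣-complement P? = count-complement P? elements

  ∣∣-singleton : (P? : Decidable P) (a : A) → (∀ x → P x ⇔ x ≡ a) → ∣ P? ∣ ≡ 1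
  ∣∣-singleton P? a P⇔≡a = trans (∣∣-cong P? (_≟ a) P⇔≡a) (count-≡ _≟_ unique (complete a))

  ∣∣-pair : (P? : Decidable P) {a b : A} → a ≢ b → (∀ x → P x ⇔ (x ≡ a ⊎ x ≡ b)) → ∣ P? ∣ ≡ 2
  ∣∣-pair {P = P} P? {a} {b} a≢b P⇔ab = begin
    ∣ P? ∣                                   ≡⟨ ∣∣-split P? (_≟ a) ⟩
    ∣ P? ∩? (_≟ a) ∣ ℕ.+ ∣ P? ∩? ∁? (_≟ a) ∣    ≡⟨ cong₂ ℕ._+_ (∣∣-singleton _ a is-a) (∣∣-singleton _ b is-b) ⟩
    2                                        ∎
    where
    is-a : ∀ x → (P x × x ≡ a) ⇔ x ≡ a
    is-a x = mk⇔ proj₂ (λ x≡a → Equivalence.from (P⇔ab x) (inj₁ x≡a) , x≡a)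
    is-b : ∀ x → (P x × x ≢ a) ⇔ x ≡ b
    is-b x = mk⇔ (λ (px , x≢a) → [ (λ x≡a → contradiction x≡a x≢a) , (λ x≡b → x≡b) ] (Equivalence.to (P⇔ab x) px))
                 (λ { refl → Equivalence.from (P⇔ab x) (inj₂ refl) , (λ b≡a → a≢b (sym b≡a)) })

  ⊆∧∣∣≥⇒⊇ : (P? : Decidable P) (Q? : Decidable Q) → P ⊆ Q → ∣ Q? ∣ ≤ ∣ P? ∣ → Q ⊆ P
  ⊆∧∣∣≥⇒⊇ P? Q? P⊆Q ∣Q∣≤∣P∣ {x} qx with P? x
  ... | yes px = px
  ... | no ¬px = contradiction ∣Q∣≤∣P∣ (ℕ.<⇒≱ ∣P∣<∣Q∣)
    where
    ∣Q∣≡∣P∣+∣Q∖P∣ : ∣ Q? ∣ ≡ ∣ P? ∣ ℕ.+ ∣ Q? ∩? ∁? P? ∣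
    ∣Q∣≡∣P∣+∣Q∖P∣ = trans (∣∣-split Q? P?)
      (cong (ℕ._+ ∣ Q? ∩? ∁? P? ∣) (∣∣-cong (Q? ∩? P?) P? λ _ → mk⇔ proj₂ λ py → P⊆Q py , py))
    ∣P∣<∣Q∣ : ∣ P? ∣ ℕ.< ∣ Q? ∣
    ∣P∣<∣Q∣ = subst (∣ P? ∣ ℕ.<_) (sym ∣Q∣≡∣P∣+∣Q∖P∣) (ℕ.m<m+n ∣ P? ∣ (∣∣-nonempty (Q? ∩? ∁? P?) (qx , ¬px)))

  ∣∣-fibres : (P? : Decidable P) (R? : Decidable R) (f : A → A) (k : ℕ) →
    (∀ {x} → P x → R (f x)) →
    (∀ {y} → R y → ∣ P? ∩? (λ x → f x ≟ y) ∣ ≡ k) →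
    ∣ P? ∣ ≡ k ℕ.* ∣ R? ∣
  ∣∣-fibres {P = P} {R = R} P? R? f k maps fibre =
    trans (∣∣-cong P? (P? ∩? (λ x → f x ∈? elements)) (λ x → mk⇔ (λ px → px , complete (f x)) proj₁)) (go unique)
    where
    go : ∀ {ys} → Unique ys → ∣ P? ∩? (λ x → f x ∈? ys) ∣ ≡ k ℕ.* count R? ys
    go {[]} [] = trans (∣∣-empty _ (λ _ ())) (sym (ℕ.*-zeroʳ k))
    go {y ∷ ys} (y∉ys ∷ u) = begin
      ∣ P? ∩? (λ x → f x ∈? y ∷ ys) ∣
        ≡⟨ ∣∣-split _ (λ x → f x ≟ y) ⟩
      ∣ (P? ∩? (λ x → f x ∈? y ∷ ys)) ∩? (λ x → f x ≟ y) ∣ ℕ.+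
      ∣ (P? ∩? (λ x → f x ∈? y ∷ ys)) ∩? ∁? (λ x → f x ≟ y) ∣
        ≡⟨ cong₂ ℕ._+_ (∣∣-cong _ _ at-y) (trans (∣∣-cong _ _ off-y) (go u)) ⟩
      ∣ P? ∩? (λ x → f x ≟ y) ∣ ℕ.+ k ℕ.* count R? ys
        ≡⟨ count-y ⟩
      k ℕ.* count R? (y ∷ ys) ∎
      where
      at-y : ∀ x → ((P x × f x ∈ y ∷ ys) × f x ≡ y) ⇔ (P x × f x ≡ y)
      at-y x = mk⇔ (λ ((px , _) , fx≡y) → px , fx≡y) (λ (px , fx≡y) → (px , here fx≡y) , fx≡y)
      off-y : ∀ x → ((P x × f x ∈ y ∷ ys) × f x ≢ y) ⇔ (P x × f x ∈ ys)
      off-y x = mk⇔ (λ { ((px , here fx≡y) , fx≢y) → contradiction fx≡y fx≢y ; ((px , there fx∈ys) , _) → px , fx∈ys })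
                    (λ (px , fx∈ys) → (px , there fx∈ys) , λ { refl → All.lookup y∉ys fx∈ys refl })
      count-y : ∣ P? ∩? (λ x → f x ≟ y) ∣ ℕ.+ k ℕ.* count R? ys ≡ k ℕ.* count R? (y ∷ ys)
      count-y with R? y
      ... | yes ry = trans (cong (ℕ._+ k ℕ.* count R? ys) (fibre ry)) (sym (ℕ.*-suc k (count R? ys)))
      ... | no ¬ry = cong (ℕ._+ k ℕ.* count R? ys) (∣∣-empty _ λ x (px , fx≡y) → ¬ry (subst R fx≡y (maps px)))

  ∣∣-double-cover : (P? : Decidable P) (R? : Decidable R) (f ι : A → A) →
    (∀ {x} → P x → R (f x)) →
    (∀ {y} → R y → ∃ λ x → P x × f x ≡ y) →
    (∀ {x} → P x → P (ι x) × f (ι x) ≡ f x × ι x ≢ x) →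
    (∀ {x x′} → P x → P x′ → f x′ ≡ f x → x′ ≡ x ⊎ x′ ≡ ι x) →
    ∣ P? ∣ ≡ 2 ℕ.* ∣ R? ∣
  ∣∣-double-cover P? R? f ι maps onto ι-swaps fibre = ∣∣-fibres P? R? f 2 maps λ ry →
    let (x , px , fx≡y) = onto ry
        (pιx , fιx≡fx , ιx≢x) = ι-swaps px
    in ∣∣-pair _ (λ x≡ιx → ιx≢x (sym x≡ιx)) λ x′ →
         mk⇔ (λ (px′ , fx′≡y) → fibre px px′ (trans fx′≡y (sym fx≡y)))
             [ (λ { refl → px , fx≡y }) , (λ { refl → pιx , trans fιx≡fx fx≡y }) ]

  ∣∣-double-cover-image : (P? : Decidable P) (f ι : A → A) →
    (∀ {x} → P x → P (ι x) × f (ι x) ≡ f x × ι x ≢ x) →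
    (∀ {x x′} → P x → P x′ → f x′ ≡ f x → x′ ≡ x ⊎ x′ ≡ ι x) →
    ∣ P? ∣ ≡ 2 ℕ.* ∣ image? P? f ∣
  ∣∣-double-cover-image P? f ι = ∣∣-double-cover P? (image? P? f) f ι (λ px → _ , px , refl) (λ image → image)

module FieldProperties (K : Field) (_≟_ : DecidableEquality (Field.Carrier K)) where
  open Field K using (Carrier; 0≢1; inverse; isCommutativeRing)

  commutativeRing : CommutativeRing 0ℓ 0ℓ
  commutativeRing = record { isCommutativeRing = isCommutativeRing }

  open CommutativeRing commutativeRing public
    using (_+_; _*_; -_; _-_; 0#; 1#; +-comm; *-comm; *-assoc; +-identityˡ; +-identityʳ; *-identityˡ; *-identityʳ;
           -‿inverseʳ; zeroˡ; zeroʳ)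
  open IntegerCoefficientSolver commutativeRing public
  open import Algebra.Properties.Ring (CommutativeRing.ring commutativeRing) public using (-‿involutive; -0#≈0#)
  open import Algebra.Properties.Group (CommutativeRing.+-group commutativeRing) using (x∙y⁻¹≈ε⇒x≈y)
  open ≡-Reasoning

  private
    variable
      x y z : Carrier

  2# : Carrier
  2# = 1# + 1#

  1≢0 : 1# ≢ 0#
  1≢0 1≡0 = 0≢1 (sym 1≡0)

  -- 0 ⁻¹ is the junk value 0#.
  _⁻¹ : Carrier → Carrier
  x ⁻¹ with x ≟ 0#
  ... | yes _   = 0#
  ... | no  x≢0 = proj₁ (inverse x x≢0)

  ⁻¹-inverseʳ : x ≢ 0# → x * x ⁻¹ ≡ 1#
  ⁻¹-inverseʳ {x} x≢0 with x ≟ 0#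
  ... | yes x≡0 = contradiction x≡0 x≢0
  ... | no  x≢0 = proj₂ (inverse x x≢0)

  ⁻¹-inverseˡ : x ≢ 0# → x ⁻¹ * x ≡ 1#
  ⁻¹-inverseˡ {x} x≢0 = trans (*-comm (x ⁻¹) x) (⁻¹-inverseʳ x≢0)

  *-cancelˡ : x ≢ 0# → x * y ≡ x * z → y ≡ z
  *-cancelˡ {x} {y} {z} x≢0 xy≡xz = begin
    y                 ≡⟨ *-identityˡ y ⟨
    1# * y            ≡⟨ cong (_* y) (⁻¹-inverseˡ x≢0) ⟨
    x ⁻¹ * x * y      ≡⟨ *-assoc (x ⁻¹) x y ⟩
    x ⁻¹ * (x * y)    ≡⟨ cong (x ⁻¹ *_) xy≡xz ⟩
    x ⁻¹ * (x * z)    ≡⟨ *-assoc (x ⁻¹) x z ⟨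
    x ⁻¹ * x * z      ≡⟨ trans (cong (_* z) (⁻¹-inverseˡ x≢0)) (*-identityˡ z) ⟩
    z                 ∎

  x*y≡0⇒x≡0∨y≡0 : x * y ≡ 0# → x ≡ 0# ⊎ y ≡ 0#
  x*y≡0⇒x≡0∨y≡0 {x} {y} xy≡0 with x ≟ 0#
  ... | yes x≡0 = inj₁ x≡0
  ... | no  x≢0 = inj₂ (*-cancelˡ x≢0 (trans xy≡0 (sym (zeroʳ x))))

  *-≢0 : x ≢ 0# → y ≢ 0# → x * y ≢ 0#
  *-≢0 x≢0 y≢0 xy≡0 = [ x≢0 , y≢0 ] (x*y≡0⇒x≡0∨y≡0 xy≡0)

  *-≢0ˡ : x * y ≢ 0# → x ≢ 0#
  *-≢0ˡ {x} {y} xy≢0 x≡0 = xy≢0 (trans (cong (_* y) x≡0) (zeroˡ y))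

  *-≢0ʳ : x * y ≢ 0# → y ≢ 0#
  *-≢0ʳ {x} {y} xy≢0 y≡0 = xy≢0 (trans (cong (x *_) y≡0) (zeroʳ x))

  -‿≢0 : x ≢ 0# → - x ≢ 0#
  -‿≢0 {x} x≢0 -x≡0 = x≢0 (trans (sym (-‿involutive x)) (trans (cong -_ -x≡0) -0#≈0#))

  ⁻¹-unique : x * y ≡ 1# → y ≡ x ⁻¹
  ⁻¹-unique {x} {y} xy≡1 = *-cancelˡ x≢0 (trans xy≡1 (sym (⁻¹-inverseʳ x≢0)))
    where
    x≢0 : x ≢ 0#
    x≢0 x≡0 = 1≢0 (trans (sym xy≡1) (trans (cong (_* y) x≡0) (zeroˡ y)))

  ⁻¹-≢0 : x ≢ 0# → x ⁻¹ ≢ 0#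
  ⁻¹-≢0 {x} x≢0 x⁻¹≡0 = 1≢0 (trans (sym (⁻¹-inverseʳ x≢0)) (trans (cong (x *_) x⁻¹≡0) (zeroʳ x)))

  ⁻¹-involutive : x ≢ 0# → x ⁻¹ ⁻¹ ≡ x
  ⁻¹-involutive x≢0 = sym (⁻¹-unique (⁻¹-inverseˡ x≢0))

  x*y⁻¹*y≡x : y ≢ 0# → x * y ⁻¹ * y ≡ x
  x*y⁻¹*y≡x {y} {x} y≢0 = trans (*-assoc x (y ⁻¹) y) (trans (cong (x *_) (⁻¹-inverseˡ y≢0)) (*-identityʳ x))

  ⁻¹-* : x ≢ 0# → y ≢ 0# → (x * y) ⁻¹ ≡ x ⁻¹ * y ⁻¹
  ⁻¹-* {x} {y} x≢0 y≢0 = sym (⁻¹-unique (begin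
    x * y * (x ⁻¹ * y ⁻¹)        ≡⟨ solve 4 (λ x y u v → x :* y :* (u :* v) := x :* u :* (y :* v)) refl x y (x ⁻¹) (y ⁻¹) ⟩
    x * x ⁻¹ * (y * y ⁻¹)        ≡⟨ cong₂ _*_ (⁻¹-inverseʳ x≢0) (⁻¹-inverseʳ y≢0) ⟩
    1# * 1#                      ≡⟨ *-identityˡ 1# ⟩
    1#                           ∎))

  x-y≡0⇒x≡y : x - y ≡ 0# → x ≡ y
  x-y≡0⇒x≡y = x∙y⁻¹≈ε⇒x≈y _ _

  x+y≡0⇒x≡-y : x + y ≡ 0# → x ≡ - y
  x+y≡0⇒x≡-y {x} {y} x+y≡0 = x-y≡0⇒x≡y (trans (cong (x +_) (-‿involutive y)) x+y≡0)

  [x+y][x-y]≡x²-y² : ∀ x y → (x + y) * (x - y) ≡ x * x - y * y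
  [x+y][x-y]≡x²-y² = solve 2 (λ x y → (x :+ y) :* (x :- y) := x :* x :- y :* y) refl

  x²≡y²⇒x≡±y : x * x ≡ y * y → x ≡ y ⊎ x ≡ - y
  x²≡y²⇒x≡±y {x} {y} x²≡y² = Data.Sum.swap (Data.Sum.map x+y≡0⇒x≡-y x-y≡0⇒x≡y (x*y≡0⇒x≡0∨y≡0 (begin
    (x + y) * (x - y)  ≡⟨ [x+y][x-y]≡x²-y² x y ⟩
    x * x - y * y      ≡⟨ cong (_- y * y) x²≡y² ⟩
    y * y - y * y      ≡⟨ -‿inverseʳ (y * y) ⟩
    0#                 ∎)))

  1⁻¹≡1 : 1# ⁻¹ ≡ 1#
  1⁻¹≡1 = sym (⁻¹-unique (*-identityˡ 1#))

  -1⁻¹≡-1 : (- 1#) ⁻¹ ≡ - 1#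
  -1⁻¹≡-1 = sym (⁻¹-unique (solve 0 (:- con (1 , 0) :* :- con (1 , 0) := con (1 , 0)) refl))

  ⁻¹-injective : x ≢ 0# → y ≢ 0# → x ⁻¹ ≡ y ⁻¹ → x ≡ y
  ⁻¹-injective {x} {y} x≢0 y≢0 x⁻¹≡y⁻¹ = trans (sym (⁻¹-involutive x≢0)) (trans (cong _⁻¹ x⁻¹≡y⁻¹) (⁻¹-involutive y≢0))

  x⁻¹≡x⇒x≡±1 : x ≢ 0# → x ⁻¹ ≡ x → x ≡ 1# ⊎ x ≡ - 1#
  x⁻¹≡x⇒x≡±1 {x} x≢0 x⁻¹≡x = x²≡y²⇒x≡±y (begin
    x * x       ≡⟨ cong (x *_) x⁻¹≡x ⟨
    x * x ⁻¹    ≡⟨ ⁻¹-inverseʳ x≢0 ⟩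
    1#          ≡⟨ *-identityˡ 1# ⟨
    1# * 1#     ∎)

  x+x⁻¹≡y+y⁻¹⇒y≡x∨y≡x⁻¹ : x ≢ 0# → y ≢ 0# → y + y ⁻¹ ≡ x + x ⁻¹ → y ≡ x ⊎ y ≡ x ⁻¹
  x+x⁻¹≡y+y⁻¹⇒y≡x∨y≡x⁻¹ {x} {y} x≢0 y≢0 f[y]≡f[x] =
    Data.Sum.map x-y≡0⇒x≡y (λ xy-1≡0 → ⁻¹-unique (x-y≡0⇒x≡y xy-1≡0)) (x*y≡0⇒x≡0∨y≡0 (begin
      (y - x) * (x * y - 1#)
        ≡⟨ solve 2 (λ x y → (y :- x) :* (x :* y :- con (1 , 0))
                         := x :* y :* y :+ x :* con (1 , 0) :- x :* x :* y :- y :* con (1 , 0)) refl x y ⟩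
      x * y * y + x * 1# - x * x * y - y * 1#
        ≡⟨ cong₂ (λ s t → x * y * y + x * s - x * x * y - y * t) (⁻¹-inverseʳ y≢0) (⁻¹-inverseʳ x≢0) ⟨
      x * y * y + x * (y * y ⁻¹) - x * x * y - y * (x * x ⁻¹)
        ≡⟨ solve 4 (λ x y u v → x :* y :* y :+ x :* (y :* v) :- x :* x :* y :- y :* (x :* u)
                             := x :* y :* ((y :+ v) :- (x :+ u))) refl x y (x ⁻¹) (y ⁻¹) ⟩
      x * y * ((y + y ⁻¹) - (x + x ⁻¹))
        ≡⟨ cong (λ t → x * y * (t - (x + x ⁻¹))) f[y]≡f[x] ⟩
      x * y * ((x + x ⁻¹) - (x + x ⁻¹))
        ≡⟨ trans (cong (x * y *_) (-‿inverseʳ _)) (zeroʳ _) ⟩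
      0#
        ∎))

≢-by-remainder : ∀ {q n r} .{{_ : ℕ.NonZero n}} s k → q % n ≡ r → s % n ≢ r → s ℕ.+ k ℕ.* n ≢ q
≢-by-remainder {q} {n} s k q%n≡r s%n≢r s+kn≡q =
  s%n≢r (trans (sym ([m+kn]%n≡m%n s k n)) (trans (cong (_% n) s+kn≡q) q%n≡r))

≡5[8]⇒≡1[4] : ∀ {q} → q % 8 ≡ 5 → q % 4 ≡ 1
≡5[8]⇒≡1[4] {q} q≡5[8] = trans (sym (m∣n⇒o%n%m≡o%m 4 8 q (divides 2 refl))) (cong (_% 4) q≡5[8])

≡5[8]⇒≡1[2] : ∀ {q} → q % 8 ≡ 5 → q % 2 ≡ 1
≡5[8]⇒≡1[2] {q} q≡5[8] = trans (sym (m∣n⇒o%n%m≡o%m 2 8 q (divides 4 refl))) (cong (_% 2) q≡5[8])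

≡1[2]⇒≢0[2] : ∀ {q} m → q % 2 ≡ 1 → 2 ℕ.* m ≢ q
≡1[2]⇒≢0[2] {q} m q%2≡1 = subst (_≢ q) (ℕ.*-comm m 2) (≢-by-remainder 0 m q%2≡1 λ ())

≡1[4]⇒≢3[4] : ∀ {q} m → q % 4 ≡ 1 → 1 ℕ.+ 2 ℕ.* (1 ℕ.+ 2 ℕ.* m) ≢ q
≡1[4]⇒≢3[4] {q} m q%4≡1 = subst (_≢ q) (rearrange m) (≢-by-remainder 3 m q%4≡1 λ ())
  where
  rearrange : ∀ m → 3 ℕ.+ m ℕ.* 4 ≡ 1 ℕ.+ 2 ℕ.* (1 ℕ.+ 2 ℕ.* m)
  rearrange = solve-∀

≡5[8]⇒≢1[8] : ∀ {q} m → q % 8 ≡ 5 → 1 ℕ.+ 2 ℕ.* (2 ℕ.* (2 ℕ.+ 2 ℕ.* m)) ≢ q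
≡5[8]⇒≢1[8] {q} m q%8≡5 = subst (_≢ q) (rearrange m) (≢-by-remainder 1 (suc m) q%8≡5 λ ())
  where
  rearrange : ∀ m → 1 ℕ.+ suc m ℕ.* 8 ≡ 1 ℕ.+ 2 ℕ.* (2 ℕ.* (2 ℕ.+ 2 ℕ.* m))
  rearrange = solve-∀

module Squares (K : Field) (E : Enumeration (Field.Carrier K)) where
  open Field K using (Carrier)
  open Enumeration E using (_≟_; elements)
  open Cardinality E
  open FieldProperties K _≟_ public
  open ≡-Reasoning

  private
    variable
      x y z : Carrier

  NonZero : Pred Carrier 0ℓ
  NonZero x = x ≢ 0#

  nonZero? : Decidable NonZero
  nonZero? = ∁? (_≟ 0#)

  IsSquare : Pred Carrier 0ℓ
  IsSquare x = ∃ λ y → y * y ≡ x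

  opaque
    isSquare? : Decidable IsSquare
    isSquare? x = ∃? (λ y → y * y ≟ x)

  -- Some square root of a square; the junk value 0# on non-squares.
  opaque
    √ : Carrier → Carrier
    √ x with isSquare? x
    ... | yes (y , _) = y
    ... | no  _       = 0#

    √-square : IsSquare x → √ x * √ x ≡ x
    √-square {x} □x with isSquare? x
    ... | yes (_ , y²≡x) = y²≡x
    ... | no  ¬□x        = contradiction □x ¬□x

  square-* : IsSquare x → IsSquare y → IsSquare (x * y)
  square-* {x} {y} (r , r²≡x) (s , s²≡y) = r * s , (begin
    r * s * (r * s)    ≡⟨ solve 2 (λ r s → r :* s :* (r :* s) := r :* r :* (s :* s)) refl r s ⟩
    r * r * (s * s)    ≡⟨ cong₂ _*_ r²≡x s²≡y ⟩
    x * y              ∎)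

  square-÷ : x ≢ 0# → IsSquare x → IsSquare (x * y) → IsSquare y
  square-÷ {x} {y} x≢0 (r , r²≡x) (s , s²≡xy) = s * r ⁻¹ , (begin
    s * r ⁻¹ * (s * r ⁻¹)          ≡⟨ solve 2 (λ s t → s :* t :* (s :* t) := s :* s :* (t :* t)) refl s (r ⁻¹) ⟩
    s * s * (r ⁻¹ * r ⁻¹)          ≡⟨ cong (_* (r ⁻¹ * r ⁻¹)) (trans s²≡xy (cong (_* y) (sym r²≡x))) ⟩
    r * r * y * (r ⁻¹ * r ⁻¹)      ≡⟨ solve 3 (λ r y t → r :* r :* y :* (t :* t) := y :* (r :* t :* (r :* t))) refl r y (r ⁻¹) ⟩
    y * (r * r ⁻¹ * (r * r ⁻¹))    ≡⟨ cong (λ u → y * (u * u)) (⁻¹-inverseʳ r≢0) ⟩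
    y * (1# * 1#)                  ≡⟨ trans (cong (y *_) (*-identityˡ 1#)) (*-identityʳ y) ⟩
    y                              ∎)
    where
    r≢0 : r ≢ 0#
    r≢0 = *-≢0ˡ (subst (_≢ 0#) (sym r²≡x) x≢0)

  √-≢0 : x ≢ 0# → IsSquare x → √ x ≢ 0#
  √-≢0 {x} x≢0 □x = *-≢0ˡ (subst NonZero (sym (√-square □x)) x≢0)

  -- The quadratic character, written additively: true on non-squares.
  χ : Carrier → Bool
  χ x = isNo (isSquare? x)

  χ-square : IsSquare x → χ x ≡ false
  χ-square {x} □x with isSquare? x
  ... | yes _   = refl
  ... | no  ¬□x = contradiction □x ¬□x

  χ-nonsquare : ¬ IsSquare x → χ x ≡ true
  χ-nonsquare {x} ¬□x with isSquare? x
  ... | yes □x = contradiction □x ¬□x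
  ... | no  _  = refl

  χ≡not⇒square⇔nonsquare : χ x ≡ not (χ y) → IsSquare x ⇔ (¬ IsSquare y)
  χ≡not⇒square⇔nonsquare {x} {y} χx≡¬χy with isSquare? x | isSquare? y
  ... | yes □x  | no ¬□y  = mk⇔ (λ _ → ¬□y) (λ _ → □x)
  ... | no ¬□x  | yes □y  = mk⇔ (λ □x → contradiction □x ¬□x) (λ ¬□y → contradiction □y ¬□y)
  ... | yes _   | yes _   = contradiction χx≡¬χy λ ()
  ... | no _    | no _    = contradiction χx≡¬χy λ ()

  1+∣nonZero∣≡∣K∣ : 1 ℕ.+ ∣ nonZero? ∣ ≡ length elements
  1+∣nonZero∣≡∣K∣ = trans (cong (ℕ._+ ∣ nonZero? ∣) (sym (∣∣-singleton (_≟ 0#) 0# λ _ → ⇔.refl)))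
                    (∣∣-complement (_≟ 0#))

  -- In characteristic 2 the fibres of x ↦ x (x + 1) are the pairs {x , x + 1}.
  2≡0⇒∣K∣-even : 2# ≡ 0# → ∃ λ m → 2 ℕ.* m ≡ length elements
  2≡0⇒∣K∣-even 2≡0 = ∣ image? U? f ∣ , sym (begin
    length elements          ≡⟨ ∣∣-all U? (λ _ → tt) ⟨
    ∣ U? ∣                   ≡⟨ ∣∣-double-cover-image U? f (_+ 1#) (λ {x} _ → tt , f[x+1]≡fx x , x+1≢x x) fibre ⟩
    2 ℕ.* ∣ image? U? f ∣    ∎)
    where
    f : Carrier → Carrier
    f x = x * (x + 1#)
    f[x+1]≡fx : ∀ x → f (x + 1#) ≡ f x
    f[x+1]≡fx x = begin
      (x + 1#) * (x + 1# + 1#)       ≡⟨ solve 1 (λ x → (x :+ con (1 , 0)) :* (x :+ con (1 , 0) :+ con (1 , 0))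
                                                     := x :* (x :+ con (1 , 0)) :+ con (2 , 0) :* (x :+ con (1 , 0))) refl x ⟩
      x * (x + 1#) + 2# * (x + 1#)   ≡⟨ cong (λ t → x * (x + 1#) + t * (x + 1#)) 2≡0 ⟩
      x * (x + 1#) + 0# * (x + 1#)   ≡⟨ trans (cong (x * (x + 1#) +_) (zeroˡ _)) (+-identityʳ _) ⟩
      x * (x + 1#)                   ∎
    x+1≢x : ∀ x → x + 1# ≢ x
    x+1≢x x x+1≡x = 1≢0 (begin
      1#            ≡⟨ solve 1 (λ x → con (1 , 0) := x :+ con (1 , 0) :- x) refl x ⟩
      x + 1# - x    ≡⟨ cong (_- x) x+1≡x ⟩
      x - x         ≡⟨ -‿inverseʳ x ⟩
      0#            ∎)
    -y≡y : ∀ y → - y ≡ y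
    -y≡y y = begin
      - y           ≡⟨ solve 1 (λ y → :- y := y :- con (2 , 0) :* y) refl y ⟩
      y - 2# * y    ≡⟨ cong (λ t → y - t * y) 2≡0 ⟩
      y - 0# * y    ≡⟨ trans (cong (λ t → y - t) (zeroˡ y)) (trans (cong (y +_) -0#≈0#) (+-identityʳ y)) ⟩
      y             ∎
    fibre : ∀ {x x′} → ⊤ → ⊤ → f x′ ≡ f x → x′ ≡ x ⊎ x′ ≡ x + 1#
    fibre {x} {x′} _ _ fx′≡fx =
      Data.Sum.map x-y≡0⇒x≡y (λ x′+x+1≡0 → trans (x+y≡0⇒x≡-y x′+x+1≡0) (-y≡y (x + 1#))) (x*y≡0⇒x≡0∨y≡0 (begin
        (x′ - x) * (x′ + (x + 1#))    ≡⟨ solve 2 (λ x x′ → (x′ :- x) :* (x′ :+ (x :+ con (1 , 0)))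
                                                      := x′ :* (x′ :+ con (1 , 0)) :- x :* (x :+ con (1 , 0))) refl x x′ ⟩
        f x′ - f x                    ≡⟨ cong (_- f x) fx′≡fx ⟩
        f x - f x                     ≡⟨ -‿inverseʳ (f x) ⟩
        0#                            ∎))

  ∣K∣-odd⇒2≢0 : length elements % 2 ≡ 1 → 2# ≢ 0#
  ∣K∣-odd⇒2≢0 ∣K∣≡1[2] 2≡0 = let (m , 2m≡∣K∣) = 2≡0⇒∣K∣-even 2≡0 in ≡1[2]⇒≢0[2] m ∣K∣≡1[2] 2m≡∣K∣

  NonzeroSquare : Pred Carrier 0ℓ
  NonzeroSquare = NonZero ∩ IsSquare

  nonzeroSquare? : Decidable NonzeroSquare
  nonzeroSquare? = nonZero? ∩? isSquare?

  NonSquare : Pred Carrier 0ℓ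
  NonSquare = NonZero ∩ ∁ IsSquare

  nonSquare? : Decidable NonSquare
  nonSquare? = nonZero? ∩? ∁? isSquare?

  nonzeroSquare-⁻¹ : NonzeroSquare x → NonzeroSquare (x ⁻¹)
  nonzeroSquare-⁻¹ {x} (x≢0 , r , r²≡x) = ⁻¹-≢0 x≢0 , r ⁻¹ , (begin
    r ⁻¹ * r ⁻¹    ≡⟨ ⁻¹-* r≢0 r≢0 ⟨
    (r * r) ⁻¹     ≡⟨ cong _⁻¹ r²≡x ⟩
    x ⁻¹           ∎)
    where
    r≢0 : r ≢ 0#
    r≢0 = *-≢0ˡ (subst NonZero (sym r²≡x) x≢0)

  1-nonzeroSquare : NonzeroSquare 1#
  1-nonzeroSquare = 1≢0 , 1# , *-identityˡ 1#

  module OddCharacteristic (2≢0 : 2# ≢ 0#) where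

    x≢-x : x ≢ 0# → x ≢ - x
    x≢-x {x} x≢0 x≡-x = x≢0 (*-cancelˡ 2≢0 (begin
      2# * x     ≡⟨ solve 1 (λ x → con (2 , 0) :* x := x :+ x) refl x ⟩
      x + x      ≡⟨ cong (x +_) x≡-x ⟩
      x - x      ≡⟨ -‿inverseʳ x ⟩
      0#         ≡⟨ zeroʳ 2# ⟨
      2# * 0#    ∎))

    ∣nonZero∣≡2*∣nonzeroSquare∣ : ∣ nonZero? ∣ ≡ 2 ℕ.* ∣ nonzeroSquare? ∣
    ∣nonZero∣≡2*∣nonzeroSquare∣ = ∣∣-double-cover nonZero? nonzeroSquare? (λ x → x * x) -_
      (λ {x} x≢0 → *-≢0 x≢0 x≢0 , x , refl)
      (λ { (y≢0 , r , r²≡y) → r , *-≢0ˡ (subst NonZero (sym r²≡y) y≢0) , r²≡y })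
      (λ {x} x≢0 → -‿≢0 x≢0 , solve 1 (λ x → :- x :* :- x := x :* x) refl x , λ -x≡x → x≢-x x≢0 (sym -x≡x))
      (λ _ _ → x²≡y²⇒x≡±y)

    ∣nonSquare∣≡∣nonzeroSquare∣ : ∣ nonSquare? ∣ ≡ ∣ nonzeroSquare? ∣
    ∣nonSquare∣≡∣nonzeroSquare∣ = ℕ.+-cancelˡ-≡ ∣ nonzeroSquare? ∣ _ _ (begin
      ∣ nonzeroSquare? ∣ ℕ.+ ∣ nonSquare? ∣    ≡⟨ ∣∣-split nonZero? isSquare? ⟨
      ∣ nonZero? ∣                             ≡⟨ ∣nonZero∣≡2*∣nonzeroSquare∣ ⟩
      2 ℕ.* ∣ nonzeroSquare? ∣                 ≡⟨ cong (∣ nonzeroSquare? ∣ ℕ.+_) (ℕ.+-identityʳ _) ⟩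
      ∣ nonzeroSquare? ∣ ℕ.+ ∣ nonzeroSquare? ∣ ∎)

    -- Multiplication by a non-square n maps the nonzero squares injectively into the
    -- non-squares; both sets have the same size, so every non-square is n times a square.
    nonsquare-*-nonsquare : NonSquare x → NonSquare y → IsSquare (y * x)
    nonsquare-*-nonsquare {n} {m} (n≢0 , ¬□n) (m≢0 , ¬□m) = subst IsSquare mn⁻¹·n²≡mn (square-* □mn⁻¹ (n , refl))
      where
      R : Pred Carrier 0ℓ
      R y = NonzeroSquare (y * n ⁻¹)
      R? : Decidable R
      R? y = nonzeroSquare? (y * n ⁻¹)
      n*x*n⁻¹≡x : ∀ x → n * x * n ⁻¹ ≡ x
      n*x*n⁻¹≡x x = begin
        n * x * n ⁻¹      ≡⟨ trans (cong (_* n ⁻¹) (*-comm n x)) (*-assoc x n (n ⁻¹)) ⟩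
        x * (n * n ⁻¹)    ≡⟨ trans (cong (x *_) (⁻¹-inverseʳ n≢0)) (*-identityʳ x) ⟩
        x                 ∎
      fibre : ∀ {y} → R y → ∣ nonzeroSquare? ∩? (λ x → n * x ≟ y) ∣ ≡ 1
      fibre {y} ry = ∣∣-singleton _ (y * n ⁻¹) λ x → mk⇔
        (λ (_ , nx≡y) → trans (sym (n*x*n⁻¹≡x x)) (cong (_* n ⁻¹) nx≡y))
        (λ { refl → ry , trans (*-comm n (y * n ⁻¹)) (x*y⁻¹*y≡x n≢0) })
      R⊆NonSquare : R ⊆ NonSquare
      R⊆NonSquare {y} (yn⁻¹≢0 , □yn⁻¹) = subst NonZero yn⁻¹n≡y (*-≢0 yn⁻¹≢0 n≢0) ,
        λ □y → ¬□n (square-÷ yn⁻¹≢0 □yn⁻¹ (subst IsSquare (sym yn⁻¹n≡y) □y))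
        where
        yn⁻¹n≡y : y * n ⁻¹ * n ≡ y
        yn⁻¹n≡y = x*y⁻¹*y≡x n≢0
      ∣nonSquare∣≤∣R∣ : ∣ nonSquare? ∣ ≤ ∣ R? ∣
      ∣nonSquare∣≤∣R∣ = ℕ.≤-reflexive (begin
        ∣ nonSquare? ∣        ≡⟨ ∣nonSquare∣≡∣nonzeroSquare∣ ⟩
        ∣ nonzeroSquare? ∣    ≡⟨ ∣∣-fibres nonzeroSquare? R? (n *_) 1 (λ {x} □x → subst NonzeroSquare (sym (n*x*n⁻¹≡x x)) □x) fibre ⟩
        1 ℕ.* ∣ R? ∣          ≡⟨ ℕ.*-identityˡ _ ⟩
        ∣ R? ∣                ∎)
      □mn⁻¹ : IsSquare (m * n ⁻¹)
      □mn⁻¹ = proj₂ (⊆∧∣∣≥⇒⊇ R? nonSquare? R⊆NonSquare ∣nonSquare∣≤∣R∣ (m≢0 , ¬□m))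
      mn⁻¹·n²≡mn : m * n ⁻¹ * (n * n) ≡ m * n
      mn⁻¹·n²≡mn = trans (sym (*-assoc (m * n ⁻¹) n n)) (cong (_* n) (x*y⁻¹*y≡x n≢0))

    χ-* : x ≢ 0# → y ≢ 0# → χ (x * y) ≡ χ x xor χ y
    χ-* {x} {y} x≢0 y≢0 with isSquare? x | isSquare? y
    ... | yes □x  | yes □y  = χ-square (square-* □x □y)
    ... | yes □x  | no ¬□y  = χ-nonsquare λ □xy → ¬□y (square-÷ x≢0 □x □xy)
    ... | no ¬□x  | yes □y  = χ-nonsquare λ □xy → ¬□x (square-÷ y≢0 □y (subst IsSquare (*-comm x y) □xy))
    ... | no ¬□x  | no ¬□y  = χ-square (nonsquare-*-nonsquare (y≢0 , ¬□y) (x≢0 , ¬□x))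

    χ-*₃ : x ≢ 0# → y ≢ 0# → z ≢ 0# → χ (x * y * z) ≡ (χ x xor χ y) xor χ z
    χ-*₃ {x} {y} {z} x≢0 y≢0 z≢0 = trans (χ-* (*-≢0 x≢0 y≢0) z≢0) (cong (_xor χ z) (χ-* x≢0 y≢0))

    χ-square-product : x ≢ 0# → y ≢ 0# → IsSquare (x * y) → χ x ≡ χ y
    χ-square-product {x} {y} x≢0 y≢0 □xy = xor≡false⇒≡ (χ x) (χ y) (trans (sym (χ-* x≢0 y≢0)) (χ-square □xy))
      where
      xor≡false⇒≡ : ∀ s t → s xor t ≡ false → s ≡ t
      xor≡false⇒≡ false false _ = refl
      xor≡false⇒≡ true  true  _ = refl

    -- Apart from ±1, the elements of P pair off with their inverses, as the fibres of x ↦ x + x ⁻¹.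
    ∣∣-inverse-closed : {P : Pred Carrier 0ℓ} (P? : Decidable P) → P ⊆ NonZero → (∀ {x} → P x → P (x ⁻¹)) → P 1# →
      ∃ λ m → ∣ P? ∣ ≡ 1 ℕ.+ ∣ P? ∩? (_≟ - 1#) ∣ ℕ.+ 2 ℕ.* m
    ∣∣-inverse-closed {P} P? P⊆NonZero P-⁻¹ P1 = ∣ image? P′? f ∣ , (begin
      ∣ P? ∣
        ≡⟨ ∣∣-split P? (_≟ 1#) ⟩
      ∣ P? ∩? (_≟ 1#) ∣ ℕ.+ ∣ P? ∩? ∁? (_≟ 1#) ∣
        ≡⟨ cong₂ ℕ._+_ ∣P∩1∣≡1 (∣∣-split _ (_≟ - 1#)) ⟩
      1 ℕ.+ (∣ (P? ∩? ∁? (_≟ 1#)) ∩? (_≟ - 1#) ∣ ℕ.+ ∣ P′? ∣)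
        ≡⟨ cong (λ k → 1 ℕ.+ (k ℕ.+ ∣ P′? ∣)) ∣P∖1∩-1∣≡∣P∩-1∣ ⟩
      1 ℕ.+ (∣ P? ∩? (_≟ - 1#) ∣ ℕ.+ ∣ P′? ∣)
        ≡⟨ cong (λ k → 1 ℕ.+ (∣ P? ∩? (_≟ - 1#) ∣ ℕ.+ k)) ∣P′∣≡2*∣image∣ ⟩
      1 ℕ.+ (∣ P? ∩? (_≟ - 1#) ∣ ℕ.+ 2 ℕ.* ∣ image? P′? f ∣)
        ≡⟨ ℕ.+-assoc 1 ∣ P? ∩? (_≟ - 1#) ∣ (2 ℕ.* ∣ image? P′? f ∣) ⟨
      1 ℕ.+ ∣ P? ∩? (_≟ - 1#) ∣ ℕ.+ 2 ℕ.* ∣ image? P′? f ∣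
        ∎)
      where
      P′ : Pred Carrier 0ℓ
      P′ x = (P x × x ≢ 1#) × x ≢ - 1#
      P′? : Decidable P′
      P′? = (P? ∩? ∁? (_≟ 1#)) ∩? ∁? (_≟ - 1#)
      f : Carrier → Carrier
      f x = x + x ⁻¹
      ∣P∩1∣≡1 : ∣ P? ∩? (_≟ 1#) ∣ ≡ 1
      ∣P∩1∣≡1 = ∣∣-singleton _ 1# λ x → mk⇔ proj₂ λ { refl → P1 , refl }
      ∣P∖1∩-1∣≡∣P∩-1∣ : ∣ (P? ∩? ∁? (_≟ 1#)) ∩? (_≟ - 1#) ∣ ≡ ∣ P? ∩? (_≟ - 1#) ∣
      ∣P∖1∩-1∣≡∣P∩-1∣ = ∣∣-cong _ _ λ x → mk⇔ (λ ((px , _) , x≡-1) → px , x≡-1)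
                                              (λ { (px , refl) → (px , λ -1≡1 → x≢-x 1≢0 (sym -1≡1)) , refl })
      ⁻¹-swaps : ∀ {x} → P′ x → P′ (x ⁻¹) × f (x ⁻¹) ≡ f x × x ⁻¹ ≢ x
      ⁻¹-swaps {x} ((px , x≢1) , x≢-1) =
        ((P-⁻¹ px , λ x⁻¹≡1 → x≢1 (⁻¹-injective x≢0 1≢0 (trans x⁻¹≡1 (sym 1⁻¹≡1)))) ,
         λ x⁻¹≡-1 → x≢-1 (⁻¹-injective x≢0 (-‿≢0 1≢0) (trans x⁻¹≡-1 (sym -1⁻¹≡-1)))) ,
        trans (cong (x ⁻¹ +_) (⁻¹-involutive x≢0)) (+-comm (x ⁻¹) x) ,
        λ x⁻¹≡x → [ x≢1 , x≢-1 ]′ (x⁻¹≡x⇒x≡±1 x≢0 x⁻¹≡x)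
        where
        x≢0 : x ≢ 0#
        x≢0 = P⊆NonZero px
      ∣P′∣≡2*∣image∣ : ∣ P′? ∣ ≡ 2 ℕ.* ∣ image? P′? f ∣
      ∣P′∣≡2*∣image∣ = ∣∣-double-cover-image P′? f _⁻¹ ⁻¹-swaps
        λ ((px , _) , _) ((px′ , _) , _) → x+x⁻¹≡y+y⁻¹⇒y≡x∨y≡x⁻¹ (P⊆NonZero px) (P⊆NonZero px′)

    1+2*∣nonzeroSquare∣≡∣K∣ : 1 ℕ.+ 2 ℕ.* ∣ nonzeroSquare? ∣ ≡ length elements
    1+2*∣nonzeroSquare∣≡∣K∣ = trans (cong suc (sym ∣nonZero∣≡2*∣nonzeroSquare∣)) 1+∣nonZero∣≡∣K∣

    -1-square : length elements % 4 ≡ 1 → IsSquare (- 1#)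
    -1-square q≡1[4] = decidable-stable (isSquare? (- 1#)) λ ¬□-1 →
      let (m , ∣□∣≡1+∣□∩-1∣+2m) = ∣∣-inverse-closed nonzeroSquare? proj₁ nonzeroSquare-⁻¹ 1-nonzeroSquare
          ∣□∩-1∣≡0 : ∣ nonzeroSquare? ∩? (_≟ - 1#) ∣ ≡ 0
          ∣□∩-1∣≡0 = ∣∣-empty _ λ { x ((_ , □x) , refl) → ¬□-1 □x }
      in ≡1[4]⇒≢3[4] m q≡1[4] (begin
        1 ℕ.+ 2 ℕ.* (1 ℕ.+ 2 ℕ.* m)
          ≡⟨ cong (λ k → 1 ℕ.+ 2 ℕ.* (1 ℕ.+ k ℕ.+ 2 ℕ.* m)) ∣□∩-1∣≡0 ⟨
        1 ℕ.+ 2 ℕ.* (1 ℕ.+ ∣ nonzeroSquare? ∩? (_≟ - 1#) ∣ ℕ.+ 2 ℕ.* m)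
          ≡⟨ cong (λ k → 1 ℕ.+ 2 ℕ.* k) ∣□∣≡1+∣□∩-1∣+2m ⟨
        1 ℕ.+ 2 ℕ.* ∣ nonzeroSquare? ∣
          ≡⟨ 1+2*∣nonzeroSquare∣≡∣K∣ ⟩
        length elements
          ∎)

    module SquareRootOfMinusOne (□-1 : IsSquare (- 1#)) where

      square-neg : IsSquare x → IsSquare (- x)
      square-neg {x} □x = subst IsSquare (solve 1 (λ x → :- con (1 , 0) :* x := :- x) refl x) (square-* □-1 □x)

      -square⇔square : IsSquare (- x) ⇔ IsSquare x
      -square⇔square {x} = mk⇔ (λ □-x → subst IsSquare (-‿involutive x) (square-neg □-x)) square-neg

      χ-neg : χ (- x) ≡ χ x
      χ-neg {x} with isSquare? x | isSquare? (- x)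
      ... | yes _   | yes _   = refl
      ... | no _    | no _    = refl
      ... | yes □x  | no ¬□-x = contradiction (square-neg □x) ¬□-x
      ... | no ¬□x  | yes □-x = contradiction (Equivalence.to -square⇔square □-x) ¬□x

      χ-√-neg : ¬ IsSquare (√ (- 1#)) → x ≢ 0# → IsSquare x → χ (√ (- x)) ≡ not (χ (√ x))
      χ-√-neg {x} ¬□i x≢0 □x = begin
        χ v                ≡⟨ [ cong χ , (λ v≡-iu → trans (cong χ v≡-iu) χ-neg) ]′ (x²≡y²⇒x≡±y v²≡[iu]²) ⟩
        χ (i * u)          ≡⟨ χ-* i≢0 u≢0 ⟩
        χ i xor χ u        ≡⟨ cong (_xor χ u) (χ-nonsquare ¬□i) ⟩
        not (χ u)          ∎
        where
        i = √ (- 1#)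
        u = √ x
        v = √ (- x)
        i≢0 : i ≢ 0#
        i≢0 = √-≢0 (-‿≢0 1≢0) □-1
        u≢0 : u ≢ 0#
        u≢0 = √-≢0 x≢0 □x
        v²≡[iu]² : v * v ≡ i * u * (i * u)
        v²≡[iu]² = begin
          v * v                  ≡⟨ √-square (square-neg □x) ⟩
          - x                    ≡⟨ solve 1 (λ x → :- x := :- con (1 , 0) :* x) refl x ⟩
          - 1# * x               ≡⟨ cong₂ _*_ (√-square □-1) (√-square □x) ⟨
          i * i * (u * u)        ≡⟨ solve 2 (λ i u → i :* i :* (u :* u) := i :* u :* (i :* u)) refl i u ⟩
          i * u * (i * u)        ∎

      FourthPower : Pred Carrier 0ℓ
      FourthPower = Image NonzeroSquare (λ x → x * x)

      fourthPower? : Decidable FourthPower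
      fourthPower? = image? nonzeroSquare? (λ x → x * x)

      ∣nonzeroSquare∣≡2*∣fourthPower∣ : ∣ nonzeroSquare? ∣ ≡ 2 ℕ.* ∣ fourthPower? ∣
      ∣nonzeroSquare∣≡2*∣fourthPower∣ = ∣∣-double-cover-image nonzeroSquare? (λ x → x * x) -_
        (λ {x} (x≢0 , □x) → (-‿≢0 x≢0 , square-neg □x) , solve 1 (λ x → :- x :* :- x := x :* x) refl x ,
                            λ -x≡x → x≢-x x≢0 (sym -x≡x))
        (λ _ _ → x²≡y²⇒x≡±y)

      -1-not-fourthPower : length elements % 8 ≡ 5 → ¬ FourthPower (- 1#)
      -1-not-fourthPower q≡5[8] ⁴-1 = ≡5[8]⇒≢1[8] m q≡5[8] (begin
        1 ℕ.+ 2 ℕ.* (2 ℕ.* (2 ℕ.+ 2 ℕ.* m))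
          ≡⟨ cong (λ k → 1 ℕ.+ 2 ℕ.* (2 ℕ.* (1 ℕ.+ k ℕ.+ 2 ℕ.* m))) ∣⁴∩-1∣≡1 ⟨
        1 ℕ.+ 2 ℕ.* (2 ℕ.* (1 ℕ.+ ∣ fourthPower? ∩? (_≟ - 1#) ∣ ℕ.+ 2 ℕ.* m))
          ≡⟨ cong (λ k → 1 ℕ.+ 2 ℕ.* (2 ℕ.* k)) ∣⁴∣≡1+∣⁴∩-1∣+2m ⟨
        1 ℕ.+ 2 ℕ.* (2 ℕ.* ∣ fourthPower? ∣)
          ≡⟨ cong (λ k → 1 ℕ.+ 2 ℕ.* k) ∣nonzeroSquare∣≡2*∣fourthPower∣ ⟨
        1 ℕ.+ 2 ℕ.* ∣ nonzeroSquare? ∣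
          ≡⟨ 1+2*∣nonzeroSquare∣≡∣K∣ ⟩
        length elements
          ∎)
        where
        ⁴⊆NonZero : FourthPower ⊆ NonZero
        ⁴⊆NonZero (x , (x≢0 , _) , refl) = *-≢0 x≢0 x≢0
        ⁴-⁻¹ : ∀ {y} → FourthPower y → FourthPower (y ⁻¹)
        ⁴-⁻¹ (x , (x≢0 , □x) , refl) = x ⁻¹ , nonzeroSquare-⁻¹ (x≢0 , □x) , sym (⁻¹-* x≢0 x≢0)
        ⁴1 : FourthPower 1#
        ⁴1 = 1# , 1-nonzeroSquare , *-identityˡ 1#
        inverse-pairing : ∃ λ m → ∣ fourthPower? ∣ ≡ 1 ℕ.+ ∣ fourthPower? ∩? (_≟ - 1#) ∣ ℕ.+ 2 ℕ.* m
        inverse-pairing = ∣∣-inverse-closed fourthPower? ⁴⊆NonZero ⁴-⁻¹ ⁴1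
        m : ℕ
        m = proj₁ inverse-pairing
        ∣⁴∣≡1+∣⁴∩-1∣+2m : ∣ fourthPower? ∣ ≡ 1 ℕ.+ ∣ fourthPower? ∩? (_≟ - 1#) ∣ ℕ.+ 2 ℕ.* m
        ∣⁴∣≡1+∣⁴∩-1∣+2m = proj₂ inverse-pairing
        ∣⁴∩-1∣≡1 : ∣ fourthPower? ∩? (_≟ - 1#) ∣ ≡ 1
        ∣⁴∩-1∣≡1 = ∣∣-singleton _ (- 1#) λ x → mk⇔ proj₂ λ { refl → ⁴-1 , refl }

      √-1-nonsquare : length elements % 8 ≡ 5 → ¬ IsSquare (√ (- 1#))
      √-1-nonsquare q≡5[8] □i = -1-not-fourthPower q≡5[8] (i , (i≢0 , □i) , √-square □-1)
        where
        i : Carrier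
        i = √ (- 1#)
        i≢0 : i ≢ 0#
        i≢0 = *-≢0ˡ (subst NonZero (sym (√-square □-1)) (-‿≢0 1≢0))



module Dynamics (K : Field) (E : Enumeration (Field.Carrier K)) where
  open Field K using (Carrier)
  open Enumeration E using (_≟_)
  open Squares K E
  open Cardinality (enumerationPair E E) public
  open ≡-Reasoning

  private
    variable
      a b c d : Carrier
      x x′ y : Pair K

  product : Pair K → Carrier
  product (a , b) = a * b

  Δ : Pair K → Carrier
  Δ (c , d) = c * c - d * d

  conj : Pair K → Pair K
  conj (c , d) = c , - d

  product-conj : product (conj y) ≡ - product y
  product-conj {c , d} = solve 2 (λ c d → c :* :- d := :- (c :* d)) refl c d

  inS? : Decidable (InS K)
  inS? (a , b) = ¬? (a ≟ 0#) ×-dec ¬? (b ≟ 0#) ×-dec ¬? (a + b ≟ 0#) ×-dec ¬? (a - b ≟ 0#)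

  InS-swap : InS K x → InS K (swap x)
  InS-swap {a , b} (a≢0 , b≢0 , a+b≢0 , a-b≢0) =
    b≢0 , a≢0 , (λ b+a≡0 → a+b≢0 (trans (+-comm a b) b+a≡0)) ,
    λ b-a≡0 → a-b≢0 (trans (cong (λ t → a - t) (x-y≡0⇒x≡y b-a≡0)) (-‿inverseʳ a))

  swap≢ : InS K x → swap x ≢ x
  swap≢ {a , b} (_ , _ , _ , a-b≢0) ba≡ab = a-b≢0 (trans (cong (_- b) (cong proj₂ ba≡ab)) (-‿inverseʳ b))

  Δ-swap : Δ (swap x) ≡ - Δ x
  Δ-swap {a , b} = solve 2 (λ a b → b :* b :- a :* a := :- (a :* a :- b :* b)) refl a b

  Δ-≢0 : InS K x → Δ x ≢ 0#
  Δ-≢0 {a , b} (_ , _ , a+b≢0 , a-b≢0) = subst NonZero ([x+y][x-y]≡x²-y² a b) (*-≢0 a+b≢0 a-b≢0)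

  module FiveModEight (2≢0 : 2# ≢ 0#) (□-1 : IsSquare (- 1#)) (¬□i : ¬ IsSquare (√ (- 1#))) where
    open OddCharacteristic 2≢0
    open SquareRootOfMinusOne □-1

    ½ : Carrier
    ½ = 2# ⁻¹

    ½≢0 : ½ ≢ 0#
    ½≢0 = ⁻¹-≢0 2≢0

    *2½ : ∀ z → z * (2# * ½) ≡ z
    *2½ z = trans (cong (z *_) (⁻¹-inverseʳ 2≢0)) (*-identityʳ z)

    mean : Pair K → Carrier
    mean (a , b) = (a + b) * ½

    halfDifference : Pair K → Carrier
    halfDifference (a , b) = (a - b) * ½

    mean-double : mean (a , b) + mean (a , b) ≡ a + b
    mean-double {a} {b} = trans (solve 3 (λ a b h → (a :+ b) :* h :+ (a :+ b) :* h := (a :+ b) :* (con (2 , 0) :* h)) refl a b ½) (*2½ (a + b))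

    c+c≡a+b⇒c≡mean : c + c ≡ a + b → c ≡ mean (a , b)
    c+c≡a+b⇒c≡mean {c} {a} {b} c+c≡a+b = begin
      c                  ≡⟨ *2½ c ⟨
      c * (2# * ½)       ≡⟨ solve 2 (λ c h → c :* (con (2 , 0) :* h) := (c :+ c) :* h) refl c ½ ⟩
      (c + c) * ½        ≡⟨ cong (_* ½) c+c≡a+b ⟩
      (a + b) * ½        ∎

    Δ[mean,d]≡halfDifference² : d * d ≡ a * b → Δ (mean (a , b) , d) ≡ halfDifference (a , b) * halfDifference (a , b)
    Δ[mean,d]≡halfDifference² {d} {a} {b} d²≡ab = begin
      (a + b) * ½ * ((a + b) * ½) - d * d
        ≡⟨ cong (λ t → (a + b) * ½ * ((a + b) * ½) - t) d²≡ab ⟩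
      (a + b) * ½ * ((a + b) * ½) - a * b
        ≡⟨ solve 3 (λ a b h → (a :+ b) :* h :* ((a :+ b) :* h) :- a :* b
                           := (a :- b) :* h :* ((a :- b) :* h) :+ a :* b :* (con (2 , 0) :* h :* (con (2 , 0) :* h) :- con (1 , 0)))
                   refl a b ½ ⟩
      D² + a * b * (2# * ½ * (2# * ½) - 1#)
        ≡⟨ cong (λ t → D² + a * b * (t * t - 1#)) (⁻¹-inverseʳ 2≢0) ⟩
      D² + a * b * (1# * 1# - 1#)
        ≡⟨ solve 3 (λ a b u → u :+ a :* b :* (con (1 , 0) :* con (1 , 0) :- con (1 , 0)) := u) refl a b D² ⟩
      D²
        ∎
      where
      D² = (a - b) * ½ * ((a - b) * ½)

    mean+halfDifference : mean (a , b) + halfDifference (a , b) ≡ a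
    mean+halfDifference {a} {b} = trans (solve 3 (λ a b h → (a :+ b) :* h :+ (a :- b) :* h := a :* (con (2 , 0) :* h)) refl a b ½) (*2½ a)

    mean-halfDifference : mean (a , b) - halfDifference (a , b) ≡ b
    mean-halfDifference {a} {b} = trans (solve 3 (λ a b h → (a :+ b) :* h :- (a :- b) :* h := b :* (con (2 , 0) :* h)) refl a b ½) (*2½ b)

    step-intro : InS K (a , b) → d * d ≡ a * b → Step K (a , b) (mean (a , b) , d)
    step-intro {a} {b} {d} s@(a≢0 , b≢0 , a+b≢0 , a-b≢0) d²≡ab =
      s , (mean≢0 , d≢0 , *-≢0ˡ [m+d][m-d]≢0 , *-≢0ʳ [m+d][m-d]≢0) , mean-double , d²≡ab
      where
      mean≢0 : mean (a , b) ≢ 0#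
      mean≢0 = *-≢0 a+b≢0 ½≢0
      d≢0 : d ≢ 0#
      d≢0 = *-≢0ˡ (subst NonZero (sym d²≡ab) (*-≢0 a≢0 b≢0))
      [m+d][m-d]≢0 : (mean (a , b) + d) * (mean (a , b) - d) ≢ 0#
      [m+d][m-d]≢0 = subst NonZero (sym (trans ([x+y][x-y]≡x²-y² _ d) (Δ[mean,d]≡halfDifference² d²≡ab)))
                           (*-≢0 (*-≢0 a-b≢0 ½≢0) (*-≢0 a-b≢0 ½≢0))

    Step⇒mean : Step K x (c , d) → c ≡ mean x
    Step⇒mean (_ , _ , c+c≡a+b , _) = c+c≡a+b⇒c≡mean c+c≡a+b

    Step⇒Δ-square : Step K x y → IsSquare (Δ y)
    Step⇒Δ-square {x} {c , d} st@(_ , _ , _ , d²≡ab) =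
      halfDifference x , sym (trans (cong (λ t → t * t - d * d) (Step⇒mean st)) (Δ[mean,d]≡halfDifference² d²≡ab))

    Step⇒product-square : Step K x y → IsSquare (product x)
    Step⇒product-square {y = c , d} (_ , _ , _ , d²≡ab) = d , d²≡ab

    Step-swap : Step K x y → Step K (swap x) y
    Step-swap {a , b} (s , t , c+c≡a+b , d²≡ab) = InS-swap s , t , trans c+c≡a+b (+-comm a b) , trans d²≡ab (*-comm a b)

    successor⁺ successor⁻ : Pair K → Pair K
    successor⁺ x = mean x , √ (product x)
    successor⁻ x = mean x , - √ (product x)

    successor-steps : InS K x → IsSquare (product x) → Step K x (successor⁺ x) × Step K x (successor⁻ x)
    successor-steps {a , b} s □ab =
      step-intro s (√-square □ab) ,
      step-intro s (trans (solve 1 (λ u → :- u :* :- u := u :* u) refl (√ (a * b))) (√-square □ab))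

    Step⇒successor : Step K x y → y ≡ successor⁺ x ⊎ y ≡ successor⁻ x
    Step⇒successor {x} {c , d} st@(_ , _ , _ , d²≡ab) =
      Data.Sum.map (cong₂ _,_ (Step⇒mean st)) (cong₂ _,_ (Step⇒mean st))
                   (x²≡y²⇒x≡±y (trans d²≡ab (sym (√-square (d , d²≡ab)))))

    predecessor : Pair K → Pair K
    predecessor (c , d) = c + √ (Δ (c , d)) , c - √ (Δ (c , d))

    step-predecessor : InS K y → IsSquare (Δ y) → Step K (predecessor y) y
    step-predecessor {c , d} t@(c≢0 , d≢0 , c+d≢0 , c-d≢0) □Δ =
      (*-≢0ˡ [c+ε][c-ε]≢0 , *-≢0ʳ [c+ε][c-ε]≢0 ,
       subst NonZero (solve 2 (λ c ε → con (2 , 0) :* c := (c :+ ε) :+ (c :- ε)) refl c ε) (*-≢0 2≢0 c≢0) ,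
       subst NonZero (solve 2 (λ c ε → con (2 , 0) :* ε := (c :+ ε) :- (c :- ε)) refl c ε) (*-≢0 2≢0 ε≢0)) ,
      t , solve 2 (λ c ε → c :+ c := (c :+ ε) :+ (c :- ε)) refl c ε , sym [c+ε][c-ε]≡d²
      where
      ε : Carrier
      ε = √ (Δ (c , d))
      [c+ε][c-ε]≡d² : (c + ε) * (c - ε) ≡ d * d
      [c+ε][c-ε]≡d² = begin
        (c + ε) * (c - ε)            ≡⟨ [x+y][x-y]≡x²-y² c ε ⟩
        c * c - ε * ε                ≡⟨ cong (λ t → c * c - t) (√-square □Δ) ⟩
        c * c - (c * c - d * d)      ≡⟨ solve 2 (λ c d → c :* c :- (c :* c :- d :* d) := d :* d) refl c d ⟩
        d * d                        ∎
      [c+ε][c-ε]≢0 : (c + ε) * (c - ε) ≢ 0#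
      [c+ε][c-ε]≢0 = subst NonZero (sym [c+ε][c-ε]≡d²) (*-≢0 d≢0 d≢0)
      ε≢0 : ε ≢ 0#
      ε≢0 = *-≢0ˡ (subst NonZero (trans ([x+y][x-y]≡x²-y² c d) (sym (√-square □Δ))) (*-≢0 c+d≢0 c-d≢0))

    Step⇒predecessor : Step K x y → x ≡ predecessor y ⊎ x ≡ swap (predecessor y)
    Step⇒predecessor {a , b} {c , d} st = Data.Sum.map ε≡D⇒ ε≡-D⇒ (x²≡y²⇒x≡±y (trans (√-square (Step⇒Δ-square st)) Δ≡D²))
      where
      ε = √ (Δ (c , d))
      D = halfDifference (a , b)
      c≡mean : c ≡ mean (a , b)
      c≡mean = Step⇒mean st
      Δ≡D² : Δ (c , d) ≡ D * D
      Δ≡D² = trans (cong (λ t → t * t - d * d) c≡mean) (Δ[mean,d]≡halfDifference² (proj₂ (proj₂ (proj₂ st))))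
      ε≡D⇒ : ε ≡ D → (a , b) ≡ predecessor (c , d)
      ε≡D⇒ ε≡D = cong₂ _,_ (sym (trans (cong₂ _+_ c≡mean ε≡D) mean+halfDifference))
                           (sym (trans (cong₂ _-_ c≡mean ε≡D) mean-halfDifference))
      ε≡-D⇒ : ε ≡ - D → (a , b) ≡ swap (predecessor (c , d))
      ε≡-D⇒ ε≡-D = cong₂ _,_ (sym (trans (cong₂ _-_ c≡mean ε≡-D)
                                         (trans (cong (mean (a , b) +_) (-‿involutive D)) mean+halfDifference)))
                             (sym (trans (cong₂ _+_ c≡mean ε≡-D) mean-halfDifference))

    Step-predecessors : Step K x y → Step K x′ y → x′ ≡ x ⊎ x′ ≡ swap x
    Step-predecessors {x} {y} {x′} st st′ = [ x≡p⇒ , x≡p̃⇒ ]′ (Step⇒predecessor st)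
      where
      p = predecessor y
      x≡p⇒ : x ≡ p → x′ ≡ x ⊎ x′ ≡ swap x
      x≡p⇒ refl = Step⇒predecessor st′
      x≡p̃⇒ : x ≡ swap p → x′ ≡ x ⊎ x′ ≡ swap x
      x≡p̃⇒ refl = Data.Sum.swap (Step⇒predecessor st′)

    □product-conj⇔□product : IsSquare (product (conj y)) ⇔ IsSquare (product y)
    □product-conj⇔□product {y} = subst (λ t → IsSquare t ⇔ IsSquare (product y)) (sym (product-conj {y})) -square⇔square

    Advancing : Pred (Pair K) 0ℓ
    Advancing x = InS K x × IsSquare (product x) × IsSquare (product (successor⁺ x))

    opaque
      advancing? : Decidable Advancing
      advancing? x = inS? x ×-dec isSquare? (product x) ×-dec isSquare? (product (successor⁺ x))

    -- (c + d)(c - d) = Δ and (c d)(c · - d) = - (c d)² make the characters of the two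
    -- products below differ exactly by χ i = true.
    χ-conj : InS K y → IsSquare (Δ y) → IsSquare (product y) →
      χ (product (successor⁺ (conj y))) ≡ not (χ (product (successor⁺ y)))
    χ-conj {c , d} (c≢0 , d≢0 , c+d≢0 , c-d≢0) □Δ □cd = begin
      χ ((c - d) * ½ * v)                  ≡⟨ χ-*₃ c-d≢0 ½≢0 v≢0 ⟩
      (χ (c - d) xor χ ½) xor χ v          ≡⟨ cong₂ (λ s t → (s xor χ ½) xor t) (sym χ[c+d]≡χ[c-d]) χv≡¬χu ⟩
      (χ (c + d) xor χ ½) xor not (χ u)    ≡⟨ not-distribʳ-xor (χ (c + d) xor χ ½) (χ u) ⟨
      not ((χ (c + d) xor χ ½) xor χ u)    ≡⟨ cong not (χ-*₃ c+d≢0 ½≢0 u≢0) ⟨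
      not (χ ((c + d) * ½ * u))            ∎
      where
      u = √ (c * d)
      v = √ (c * - d)
      cd≢0 : c * d ≢ 0#
      cd≢0 = *-≢0 c≢0 d≢0
      u≢0 : u ≢ 0#
      u≢0 = √-≢0 cd≢0 □cd
      v≢0 : v ≢ 0#
      v≢0 = √-≢0 (*-≢0 c≢0 (-‿≢0 d≢0)) (Equivalence.from (□product-conj⇔□product {c , d}) □cd)
      χv≡¬χu : χ v ≡ not (χ u)
      χv≡¬χu = trans (cong (λ t → χ (√ t)) (product-conj {c , d})) (χ-√-neg ¬□i cd≢0 □cd)
      χ[c+d]≡χ[c-d] : χ (c + d) ≡ χ (c - d)
      χ[c+d]≡χ[c-d] = χ-square-product c+d≢0 c-d≢0 (subst IsSquare (sym ([x+y][x-y]≡x²-y² c d)) □Δ)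

    successors-advancing : Advancing x → Advancing (successor⁺ x) ⇔ (¬ Advancing (successor⁻ x))
    successors-advancing {x} (s , □ab , □γδ) = mk⇔
      (λ (_ , _ , □⁺) (_ , _ , □⁻) → Equivalence.to square⇔nonsquare □⁺ □⁻)
      (λ ¬adv⁻ → t⁺ , □γδ , Equivalence.from square⇔nonsquare λ □⁻ → ¬adv⁻ (t⁻ , □γ-δ , □⁻))
      where
      st⁺ = proj₁ (successor-steps s □ab)
      t⁺ = proj₁ (proj₂ st⁺)
      t⁻ = proj₁ (proj₂ (proj₂ (successor-steps s □ab)))
      □γ-δ : IsSquare (product (successor⁻ x))
      □γ-δ = Equivalence.from (□product-conj⇔□product {successor⁺ x}) □γδ
      square⇔nonsquare : IsSquare (product (successor⁺ (successor⁺ x))) ⇔ (¬ IsSquare (product (successor⁺ (successor⁻ x))))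
      square⇔nonsquare = χ≡not⇒square⇔nonsquare
        (trans (sym (not-involutive _)) (cong not (sym (χ-conj t⁺ (Step⇒Δ-square st⁺) □γδ))))

    next : Pair K → Pair K
    next x = if isYes (advancing? (successor⁺ x)) then successor⁺ x else successor⁻ x

    next-step : Advancing x → Step K x (next x) × Advancing (next x)
    next-step {x} adv@(s , □ab , _) with advancing? (successor⁺ x)
    ... | yes adv⁺ = proj₁ (successor-steps s □ab) , adv⁺
    ... | no ¬adv⁺ = proj₂ (successor-steps s □ab) ,
      decidable-stable (advancing? (successor⁻ x)) λ ¬adv⁻ → ¬adv⁺ (Equivalence.from (successors-advancing adv) ¬adv⁻)

    next-unique : Advancing x → Step K x y → Advancing y → y ≡ next x
    next-unique {x} {y} adv st adv-y = [ y≡y⁺⇒ , y≡y⁻⇒ ]′ (Step⇒successor {x} {y} st)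
      where
      y≡y⁺⇒ : y ≡ successor⁺ x → y ≡ next x
      y≡y⁺⇒ y≡y⁺ with advancing? (successor⁺ x)
      ... | yes _    = y≡y⁺
      ... | no ¬adv⁺ = contradiction (subst Advancing y≡y⁺ adv-y) ¬adv⁺
      y≡y⁻⇒ : y ≡ successor⁻ x → y ≡ next x
      y≡y⁻⇒ y≡y⁻ with advancing? (successor⁺ x)
      ... | yes adv⁺ = contradiction (subst Advancing y≡y⁻ adv-y) (Equivalence.to (successors-advancing adv) adv⁺)
      ... | no _     = y≡y⁻

    next-swap : next (swap x) ≡ next x
    next-swap {a , b} = cong₂ (λ y⁺ y⁻ → if isYes (advancing? y⁺) then y⁺ else y⁻)
                              (cong₂ _,_ mean≡ (cong √ (*-comm b a))) (cong₂ _,_ mean≡ (cong (λ t → - √ t) (*-comm b a)))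
      where
      mean≡ : mean (b , a) ≡ mean (a , b)
      mean≡ = cong (_* ½) (+-comm b a)

    Advancing⇒Adv : ∀ n → Advancing x → Adv K n x
    Advancing⇒Adv zero (s , _) = s
    Advancing⇒Adv {x} (suc n) adv = next x , proj₁ (next-step adv) , Advancing⇒Adv n (proj₂ (next-step adv))

    Adv₂⇒Advancing : Adv K 2 x → Advancing x
    Adv₂⇒Advancing {x} (y , st , _ , st′ , _) = proj₁ st , Step⇒product-square st ,
      [ (λ y≡y⁺ → subst (IsSquare ∘ product) y≡y⁺ □y) ,
        (λ y≡y⁻ → Equivalence.to (□product-conj⇔□product {successor⁺ x}) (subst (IsSquare ∘ product) y≡y⁻ □y)) ]′
      (Step⇒successor st)
      where
      □y : IsSquare (product y)
      □y = Step⇒product-square st′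

    Step⇒Advancing : Step K x y → Advancing y → Advancing x
    Step⇒Advancing {y = y} st adv-y = Adv₂⇒Advancing (y , st , next y , proj₁ (next-step adv-y) , proj₁ (proj₂ (next-step adv-y)))

    AdvInf⇔Advancing : AdvInf K x ⇔ Advancing x
    AdvInf⇔Advancing = mk⇔ (λ adv∞ → Adv₂⇒Advancing (adv∞ 2)) (λ adv n → Advancing⇒Adv n adv)

    Advancing-swap : Advancing x → Advancing (swap x)
    Advancing-swap {x} adv =
      Step⇒Advancing {swap x} {next x} (Step-swap {x} {next x} (proj₁ (next-step adv))) (proj₂ (next-step adv))

    HasPredecessor : Pred (Pair K) 0ℓ
    HasPredecessor y = InS K y × IsSquare (Δ y)

    opaque
      hasPredecessor? : Decidable HasPredecessor
      hasPredecessor? y = inS? y ×-dec isSquare? (Δ y)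

    Step⇒HasPredecessor : Step K x y → HasPredecessor y
    Step⇒HasPredecessor {x} {y} st = proj₁ (proj₂ st) , Step⇒Δ-square {x} {y} st

    HasPredecessor-swap : HasPredecessor x → HasPredecessor (swap x)
    HasPredecessor-swap {x} (s , □Δ) = InS-swap s , subst IsSquare (sym (Δ-swap {x})) (square-neg □Δ)

    HasPredecessor-predecessor : Step K x y → HasPredecessor x → HasPredecessor (predecessor y)
    HasPredecessor-predecessor {x} {y} st hp-x =
      [ (λ x≡p → subst HasPredecessor x≡p hp-x) , (λ x≡p̃ → subst HasPredecessor (cong swap x≡p̃) (HasPredecessor-swap hp-x)) ]′
        (Step⇒predecessor {x} {y} st)

    -- Δ (c + ε , c - ε) = 4 c ε, and swapping (a , b) negates Δ, hence flips the character of ε = √ Δ.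
    χ-predecessor-swap : HasPredecessor x → IsSquare (product x) →
      χ (Δ (predecessor (swap x))) ≡ not (χ (Δ (predecessor x)))
    χ-predecessor-swap {a , b} (s@(a≢0 , b≢0 , _ , _) , □Δ) □ab = begin
      χ (Δ (predecessor (b , a)))             ≡⟨ cong χ (Δ-predecessor b a) ⟩
      χ (2# * 2# * b * η′)                    ≡⟨ χ-*₃ 4≢0 b≢0 η′≢0 ⟩
      (χ (2# * 2#) xor χ b) xor χ η′          ≡⟨ cong₂ (λ s t → (χ (2# * 2#) xor s) xor t)
                                                       (sym (χ-square-product a≢0 b≢0 □ab)) χη′≡¬χη ⟩
      (χ (2# * 2#) xor χ a) xor not (χ η)     ≡⟨ not-distribʳ-xor (χ (2# * 2#) xor χ a) (χ η) ⟨
      not ((χ (2# * 2#) xor χ a) xor χ η)     ≡⟨ cong not (χ-*₃ 4≢0 a≢0 η≢0) ⟨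
      not (χ (2# * 2# * a * η))               ≡⟨ cong (not ∘ χ) (Δ-predecessor a b) ⟨
      not (χ (Δ (predecessor (a , b))))       ∎
      where
      η = √ (Δ (a , b))
      η′ = √ (Δ (b , a))
      Δ-predecessor : ∀ c d → Δ (predecessor (c , d)) ≡ 2# * 2# * c * √ (Δ (c , d))
      Δ-predecessor c d = solve 2 (λ c ε → (c :+ ε) :* (c :+ ε) :- (c :- ε) :* (c :- ε) := con (2 , 0) :* con (2 , 0) :* c :* ε)
                                  refl c (√ (Δ (c , d)))
      4≢0 : 2# * 2# ≢ 0#
      4≢0 = *-≢0 2≢0 2≢0
      Δ≢0 : Δ (a , b) ≢ 0#
      Δ≢0 = Δ-≢0 s
      η≢0 : η ≢ 0#
      η≢0 = √-≢0 Δ≢0 □Δ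
      η′≢0 : η′ ≢ 0#
      η′≢0 = √-≢0 (subst NonZero (sym (Δ-swap {a , b})) (-‿≢0 Δ≢0)) (proj₂ (HasPredecessor-swap (s , □Δ)))
      χη′≡¬χη : χ η′ ≡ not (χ η)
      χη′≡¬χη = trans (cong (χ ∘ √) (Δ-swap {a , b})) (χ-√-neg ¬□i Δ≢0 □Δ)

    predecessors-retreating : HasPredecessor x → IsSquare (product x) →
      HasPredecessor (predecessor (swap x)) ⇔ (¬ HasPredecessor (predecessor x))
    predecessors-retreating {x} hp@(s , □Δ) □ab = mk⇔
      (λ (_ , □⁻) (_ , □⁺) → Equivalence.to square⇔nonsquare □⁻ □⁺)
      (λ ¬hp⁺ → t⁻ , Equivalence.from square⇔nonsquare λ □⁺ → ¬hp⁺ (t⁺ , □⁺))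
      where
      t⁺ = proj₁ (step-predecessor {x} s □Δ)
      t⁻ = proj₁ (step-predecessor {swap x} (InS-swap s) (proj₂ (HasPredecessor-swap hp)))
      square⇔nonsquare : IsSquare (Δ (predecessor (swap x))) ⇔ (¬ IsSquare (Δ (predecessor x)))
      square⇔nonsquare = χ≡not⇒square⇔nonsquare (χ-predecessor-swap hp □ab)

    Retreating : Pred (Pair K) 0ℓ
    Retreating y = HasPredecessor y × HasPredecessor (predecessor y)

    retreating-predecessor : Retreating y → ∃ λ x → Step K x y × Retreating x
    retreating-predecessor {y} ((t , □Δ) , hp-p) = extend (hasPredecessor? (predecessor p))
      where
      p = predecessor y
      st : Step K p y
      st = step-predecessor {y} t □Δ
      extend : Dec (HasPredecessor (predecessor p)) → ∃ λ x → Step K x y × Retreating x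
      extend (yes hp-pp) = p , st , hp-p , hp-pp
      extend (no ¬hp-pp) = swap p , Step-swap {p} {y} st , HasPredecessor-swap hp-p ,
        Equivalence.from (predecessors-retreating hp-p (Step⇒product-square {p} {y} st)) ¬hp-pp

    Retreating⇒Back : ∀ n → Retreating y → Back K n y
    Retreating⇒Back zero ((t , _) , _) = t
    Retreating⇒Back (suc n) r = let (x , st , r-x) = retreating-predecessor r in x , st , Retreating⇒Back n r-x

    Back₂⇒Retreating : Back K 2 y → Retreating y
    Back₂⇒Retreating {y} (x , st , w , st′ , _) =
      Step⇒HasPredecessor {x} {y} st , HasPredecessor-predecessor {x} {y} st (Step⇒HasPredecessor {w} {x} st′)

    BackInf⇔Retreating : BackInf K y ⇔ Retreating y
    BackInf⇔Retreating = mk⇔ (λ back∞ → Back₂⇒Retreating (back∞ 2)) (λ r n → Retreating⇒Back n r)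

    next-double-cover : {P R : Pred (Pair K) 0ℓ} (P? : Decidable P) (R? : Decidable R) →
      P ⊆ Advancing → (∀ {x} → P x → P (swap x)) → (∀ {x} → P x → R (next x)) →
      (∀ {y} → R y → Advancing y × HasPredecessor y × P (predecessor y)) →
      ∣ P? ∣ ≡ 2 ℕ.* ∣ R? ∣
    next-double-cover {P} {R} P? R? P⊆Advancing P-swap maps onto = ∣∣-double-cover P? R? next swap maps onto′ swaps fibre
      where
      onto′ : ∀ {y} → R y → ∃ λ x → P x × next x ≡ y
      onto′ {y} ry = let (adv-y , (t , □Δ) , p-p) = onto ry in
        predecessor y , p-p , sym (next-unique (P⊆Advancing p-p) (step-predecessor {y} t □Δ) adv-y)
      swaps : ∀ {x} → P x → P (swap x) × next (swap x) ≡ next x × swap x ≢ x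
      swaps {x} px = P-swap px , next-swap {x} , swap≢ (proj₁ (P⊆Advancing px))
      fibre : ∀ {x x′} → P x → P x′ → next x′ ≡ next x → x′ ≡ x ⊎ x′ ≡ swap x
      fibre {x} {x′} px px′ e = Step-predecessors {x} {next x} {x′} (proj₁ (next-step (P⊆Advancing px)))
                                                   (subst (Step K x′) e (proj₁ (next-step (P⊆Advancing px′))))

    Cyclic : Pred (Pair K) 0ℓ
    Cyclic = Advancing ∩ Retreating

    Cyc⇔Cyclic : Cyc K x ⇔ Cyclic x
    Cyc⇔Cyclic = mk⇔ (λ (adv∞ , back∞) → Equivalence.to AdvInf⇔Advancing adv∞ , Equivalence.to BackInf⇔Retreating back∞)
                     (λ (adv , r) → Equivalence.from AdvInf⇔Advancing adv , Equivalence.from BackInf⇔Retreating r)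

    opaque
      retreating? : Decidable Retreating
      retreating? y = hasPredecessor? y ×-dec hasPredecessor? (predecessor y)

    cyclic? : Decidable Cyclic
    cyclic? = advancing? ∩? retreating?

    Advancing-predecessor : Advancing y → HasPredecessor y → Advancing (predecessor y)
    Advancing-predecessor {y} adv-y (t , □Δ) = Step⇒Advancing (step-predecessor {y} t □Δ) adv-y

    HasPredecessor-next : Advancing x → HasPredecessor (next x)
    HasPredecessor-next adv = Step⇒HasPredecessor (proj₁ (next-step adv))

    ∣advancing∣≡2*∣advancing∩hasPredecessor∣ : ∣ advancing? ∣ ≡ 2 ℕ.* ∣ advancing? ∩? hasPredecessor? ∣
    ∣advancing∣≡2*∣advancing∩hasPredecessor∣ = next-double-cover advancing? (advancing? ∩? hasPredecessor?)
      (λ adv → adv) Advancing-swap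
      (λ adv → proj₂ (next-step adv) , HasPredecessor-next adv)
      (λ (adv-y , hp-y) → adv-y , hp-y , Advancing-predecessor adv-y hp-y)

    ∣advancing∩hasPredecessor∣≡2*∣cyclic∣ : ∣ advancing? ∩? hasPredecessor? ∣ ≡ 2 ℕ.* ∣ cyclic? ∣
    ∣advancing∩hasPredecessor∣≡2*∣cyclic∣ = next-double-cover (advancing? ∩? hasPredecessor?) cyclic?
      proj₁ (λ (adv , hp) → Advancing-swap adv , HasPredecessor-swap hp)
      (λ {x} (adv , hp) → proj₂ (next-step adv) , HasPredecessor-next adv ,
                          HasPredecessor-predecessor {x} {next x} (proj₁ (next-step adv)) hp)
      (λ (adv-y , hp-y , hp-p) → adv-y , hp-y , Advancing-predecessor adv-y hp-y , hp-p)

    ∣advancing∣≡4*∣cyclic∣ : ∣ advancing? ∣ ≡ 4 ℕ.* ∣ cyclic? ∣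
    ∣advancing∣≡4*∣cyclic∣ = begin
      ∣ advancing? ∣                              ≡⟨ ∣advancing∣≡2*∣advancing∩hasPredecessor∣ ⟩
      2 ℕ.* ∣ advancing? ∩? hasPredecessor? ∣     ≡⟨ cong (2 ℕ.*_) ∣advancing∩hasPredecessor∣≡2*∣cyclic∣ ⟩
      2 ℕ.* (2 ℕ.* ∣ cyclic? ∣)                   ≡⟨ ℕ.*-assoc 2 2 ∣ cyclic? ∣ ⟨
      4 ℕ.* ∣ cyclic? ∣                           ∎

open import Data.Nat using (_*_)

proposition1p6 : (q : ℕ) → IsPrimePower q → q % 8 ≡ 5 →
    (K : Field) → HasSize K q →
    ∃ λ c → ∃ λ a → HasCard (Cyc K) c × HasCard (AdvInf K) a × (4 * c ≡ a)
proposition1p6 q _ q≡5[8] K Fin↔K =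
  ∣ cyclic? ∣ , ∣ advancing? ∣ ,
  hasCard cyclic? (λ _ → ⇔.sym Cyc⇔Cyclic) , hasCard advancing? (λ _ → ⇔.sym AdvInf⇔Advancing) ,
  sym ∣advancing∣≡4*∣cyclic∣
  where
  E : Enumeration (Field.Carrier K)
  E = enumerationFromFin Fin↔K
  open Squares K E using (2#; ∣K∣-odd⇒2≢0; IsSquare; module OddCharacteristic)
  open Field K using (0#; 1#; -_)
  ∣K∣ : ℕ
  ∣K∣ = length (Enumeration.elements E)
  ∣K∣≡5[8] : ∣K∣ % 8 ≡ 5
  ∣K∣≡5[8] = trans (cong (_% 8) (length-enumerationFromFin Fin↔K)) q≡5[8]
  2≢0 : 2# ≢ 0#
  2≢0 = ∣K∣-odd⇒2≢0 (≡5[8]⇒≡1[2] {∣K∣} ∣K∣≡5[8])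
  open OddCharacteristic 2≢0 using (-1-square; module SquareRootOfMinusOne)
  □-1 : IsSquare (- 1#)
  □-1 = -1-square (≡5[8]⇒≡1[4] {∣K∣} ∣K∣≡5[8])
  open Dynamics K E
  open FiveModEight 2≢0 □-1 (SquareRootOfMinusOne.√-1-nonsquare □-1 ∣K∣≡5[8])
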